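{- Let $m\ge 3$, let $n \ge 6$ be even, let $\ell\in\mathbb{Z}_n$ have the same parity as $m$, and let $k_0 = 1, k_1,\dots,k_{m-1} \in \mathbb{Z}_n$ all be coprime to $n$. Let $\Gamma = \mathcal{X}_a(m,n,[k_0,\dots,k_{m-1}],\ell)$ and assume there exists a vertex-transitive subgroup $G \le \mathrm{Aut}(\Gamma)$ preserving the $2$-factor $\mathcal{C}$. Then one can relabel the vertices within each of the cycles of $\mathcal{C}$ (i.e. there is an isomorphism mapping each $V_i$ onto the set with the same first index) so that one of the following holds: (1) $\Gamma = \mathrm{HTG}(m,n,\ell')$ for some $\ell' \in \mathbb{Z}_n$; or (2) $m$ is even and there exist $\ell' \in \mathbb{Z}_n$ and an odd $k \in \mathbb{Z}_n$ with $2k \notin\{2,-2\}$ and $2k^2 \in\{2,-2\}$ such that $\Gamma = \mathcal{X}_a(m,n,[1,k,1,k,\dots,1,k],\ell')$.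
   Context: For $r_0,\dots,r_{m-1}\in\mathbb{Z}_n$ coprime to $n$ and $\ell$ of the same parity as $m$, $\mathcal{X}_a(m,n,[r_0,\dots,r_{m-1}],\ell)$ is the graph with vertices $u_{i,j}$ ($i\in\mathbb{Z}_m$, $j\in\mathbb{Z}_n$) and edges: $u_{i,j}u_{i,j+r_i}$ for all $i,j$; $u_{i,j}u_{i+1,j}$ for integers $0\le i\le m-2$ and $j\equiv i\pmod 2$; $u_{m-1,j}u_{0,j+\ell}$ for $j\equiv m-1\pmod 2$. $V_i = \{u_{i,j}:j\in\mathbb{Z}_n\}$, $C_i$ is the $n$-cycle induced on $V_i$, $\mathcal{C}=\{C_i\}$; a group preserves $\mathcal{C}$ if it maps cycles of $\mathcal{C}$ to cycles of $\mathcal{C}$. $\mathrm{HTG}(m,n,\ell')=\mathcal{X}_a(m,n,[1,1,\dots,1],\ell')$ (honeycomb toroidal graph). -}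

module Defs where

open import Data.Nat using (ℕ; zero; suc; _+_; _*_; _∸_; _<_; _%_; NonZero)
open import Data.Nat.DivMod using (m%n<n)
open import Data.Fin using (Fin; toℕ; fromℕ<)
open import Data.Product using (Σ; _×_; _,_; proj₁; ∃)
open import Data.Sum using (_⊎_)
open import Relation.Binary.PropositionalEquality using (_≡_)
open import Function using (_∘_; id)
open import Function.Bundles using (_⇔_)
open import Function.Definitions using (Bijective)

-- ℤ_n represented by Fin n (residues 0..n-1); arithmetic mod n.
[_]mod_ : ℕ → (n : ℕ) → .{{NonZero n}} → Fin n
[ k ]mod n = fromℕ< (m%n<n k n)

module _ (n : ℕ) .{{_ : NonZero n}} where
  _+ₙ_ : Fin n → Fin n → Fin n
  a +ₙ b = [ toℕ a + toℕ b ]mod n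

  _*ₙ_ : Fin n → Fin n → Fin n
  a *ₙ b = [ toℕ a * toℕ b ]mod n

  -ₙ_ : Fin n → Fin n
  -ₙ a = [ n ∸ toℕ a ]mod n

-- Vertex u_{i,j} is the pair (i , j).
Vertex : ℕ → ℕ → Set
Vertex m n = Fin m × Fin n

-- Directed generators of the edges of X_a(m,n,[r_0..r_{m-1}],ℓ)
-- (the parity/coprimality side conditions on r and ℓ are hypotheses of the theorem).
data XaEdge (m n : ℕ) .{{_ : NonZero m}} .{{_ : NonZero n}}
            (r : Fin m → Fin n) (ℓ : Fin n) : Vertex m n → Vertex m n → Set where
  cyc  : ∀ i j → XaEdge m n r ℓ (i , j) (i , _+ₙ_ n j (r i))
  rung : ∀ i j → suc (toℕ i) < m → toℕ j % 2 ≡ toℕ i % 2 →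
         XaEdge m n r ℓ (i , j) ([ suc (toℕ i) ]mod m , j)
  -- u_{m-1,j} u_{0,j+ℓ} for j ≡ m-1 (mod 2)   (here i = m-1, and [ m ]mod m = 0)
  wrap : ∀ i j → suc (toℕ i) ≡ m → toℕ j % 2 ≡ toℕ i % 2 →
         XaEdge m n r ℓ (i , j) ([ suc (toℕ i) ]mod m , _+ₙ_ n j ℓ)

Xa : (m n : ℕ) .{{_ : NonZero m}} .{{_ : NonZero n}} →
     (Fin m → Fin n) → Fin n → Vertex m n → Vertex m n → Set
Xa m n r ℓ u v = XaEdge m n r ℓ u v ⊎ XaEdge m n r ℓ v u

HTG : (m n : ℕ) .{{_ : NonZero m}} .{{_ : NonZero n}} →
      Fin n → Vertex m n → Vertex m n → Set
HTG m n ℓ = Xa m n (λ _ → [ 1 ]mod n) ℓ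

alt : (m n : ℕ) .{{_ : NonZero n}} → Fin n → Fin m → Fin n
alt m n k i with toℕ i % 2
... | zero  = [ 1 ]mod n
... | suc _ = k

-- A graph on vertex set V is a binary adjacency relation.
-- Isomorphism between graphs on V and W.
IsIsomorphism : {V W : Set} → (V → V → Set) → (W → W → Set) → (V → W) → Set
IsIsomorphism E F f = Bijective _≡_ _≡_ f × (∀ u v → E u v ⇔ F (f u) (f v))

IsAutomorphism : {V : Set} → (V → V → Set) → (V → V) → Set
IsAutomorphism E = IsIsomorphism E E

record IsAutSubgroup {V : Set} (E : V → V → Set) (G : (V → V) → Set) : Set₁ where
  field
    aut   : ∀ {g} → G g → IsAutomorphism E g
    idG   : G id
    compG : ∀ {g h} → G g → G h → G (g ∘ h)
    invG  : ∀ {g} → G g → Σ (V → V) λ h → G h × (∀ v → h (g v) ≡ v) × (∀ v → g (h v) ≡ v)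

VertexTransitive : {V : Set} → ((V → V) → Set) → Set
VertexTransitive {V} G = ∀ (u v : V) → Σ (V → V) λ g → G g × g u ≡ v

-- G preserves the 2-factor 𝒞 = {C_i}: each g maps every cycle C_i (vertex set V_i)
-- onto some cycle C_{i'} (V_{i'}).
Preserves𝒞 : {m n : ℕ} → ((Vertex m n → Vertex m n) → Set) → Set
Preserves𝒞 {m} {n} G = ∀ g → G g → ∀ (i : Fin m) → ∃ λ (i' : Fin m) →
  ∀ (j : Fin n) → proj₁ (g (i , j)) ≡ i'

-- Every g ∈ G maps each cycle C_i onto a cycle C_{λ(i)} (λ = layer g) as a rotation or a
-- reflection, so it turns steps of k_i along C_i into steps of ±k_{λ(i)}.  Translating by the
-- even element 2k_i is an automorphism, and since every vertex has a unique neighbour outside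
-- its cycle, g moves both ends of a translated edge between C_i and C_j by the same amount;
-- this gives 2k_{λ(i)} k_j ≡ ±2 k_i k_{λ(j)} (mod n).  Choosing g with g(u_{i,i}) = u_{0,0},
-- resp. g(u_{1,0}) = u_{0,0}, yields k_{i+1} ≡ ±k_i k_1 and k_1² ≡ ±1 modulo h = n/2, hence
-- k_i ≡ ±k_1^(i mod 2) (mod h), where going once around the cycles forces k_1 ≡ ±1 unless m
-- is even.  Finally a congruence k_i ≡ ±T_i modulo h lifts to an isomorphism onto X_a with
-- jumps T_i by shifting suitable vertices of each cycle by h.

module Submission where

open import Data.Bool using (Bool; true; false; _xor_; not)
import Data.Bool.Properties as Boolₚ
open import Data.Empty using (⊥-elim)
open import Data.Fin using (Fin; toℕ)
import Data.Fin.Properties as Finₚ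
open import Data.Integer using (ℤ; +_; -_; _+_; _*_; _-_; _⊖_; _^_; ∣_∣)
import Data.Integer.DivMod as ℤD
open import Data.Integer.Divisibility.Signed
  using (_∣_; _∣?_; divides; ∣m∣n⇒∣m+n; ∣n⇒∣m*n; ∣m⇒∣-m; ∣-trans; ∣⇒∣ᵤ; ∣ᵤ⇒∣)
import Data.Integer.Properties as ℤₚ
open import Data.Integer.Tactic.RingSolver using (solve-∀)
open import Data.Nat as ℕ using (ℕ; zero; suc; NonZero; _%_; _∸_; _≤_)
import Data.Nat.Coprimality as Coprime
open Coprime using (Coprime)
import Data.Nat.DivMod as ℕD
import Data.Nat.Divisibility as ℕ∣
open import Data.Nat.GCD using (module Bézout)
import Data.Nat.Properties as ℕₚ
open import Data.Product using (Σ; _×_; _,_; proj₁; proj₂)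
open import Data.Sum using (_⊎_; inj₁; inj₂; [_,_]′)
open import Function using (_∘_)
open import Function.Bundles using (Equivalence; mk⇔; _⇔_)
open import Relation.Binary.Bundles using (Setoid)
open import Relation.Binary.Definitions using (Reflexive; Symmetric; Transitive; tri<; tri≈; tri>)
open import Relation.Binary.PropositionalEquality
import Relation.Binary.Reasoning.Setoid as SetoidReasoning
open import Relation.Binary.Structures using (IsEquivalence)
open import Relation.Nullary using (¬_; contradiction; Dec; yes; no; does)
open import Relation.Nullary.Decidable using (map′)

open import Defs

IsSign : ℤ → Set
IsSign σ = σ ≡ + 1 ⊎ σ ≡ - + 1

sign*sign≡1 : ∀ {σ} → IsSign σ → σ * σ ≡ + 1
sign*sign≡1 (inj₁ refl) = refl
sign*sign≡1 (inj₂ refl) = refl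

sign-* : ∀ {σ τ} → IsSign σ → IsSign τ → IsSign (σ * τ)
sign-* (inj₁ refl) (inj₁ refl) = inj₁ refl
sign-* (inj₁ refl) (inj₂ refl) = inj₂ refl
sign-* (inj₂ refl) (inj₁ refl) = inj₂ refl
sign-* (inj₂ refl) (inj₂ refl) = inj₁ refl

infixl 6 _⊕_ _⊝_

_⊕_ : ∀ {n} .{{_ : NonZero n}} → Fin n → Fin n → Fin n
_⊕_ {n} = _+ₙ_ n

_⊝_ : ∀ {n} .{{_ : NonZero n}} → Fin n → Fin n → Fin n
_⊝_ {n} a b = a ⊕ -ₙ_ n b

module Modular (n : ℕ) .{{_ : NonZero n}} where

  infix 4 _≈_ _≈±_ _≈?_ _≈±?_

  -- A record rather than a synonym, so that x and y can be inferred from a proof.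
  record _≈_ (x y : ℤ) : Set where
    constructor mk≈
    field n∣x-y : + n ∣ x - y
  open _≈_ public

  ≈-refl : Reflexive _≈_
  ≈-refl {x} = mk≈ (divides (+ 0) (ℤₚ.+-inverseʳ x))

  ≈-sym : Symmetric _≈_
  ≈-sym {x} {y} (mk≈ p) = mk≈ (subst (+ n ∣_) (negate-difference x y) (∣m⇒∣-m p))
    where
    negate-difference : ∀ x y → - (x - y) ≡ y - x
    negate-difference = solve-∀

  ≈-trans : Transitive _≈_
  ≈-trans {x} {y} {z} (mk≈ p) (mk≈ q) = mk≈ (subst (+ n ∣_) (telescope x y z) (∣m∣n⇒∣m+n p q))
    where
    telescope : ∀ x y z → (x - y) + (y - z) ≡ x - z
    telescope = solve-∀

  ≈-isEquivalence : IsEquivalence _≈_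
  ≈-isEquivalence = record { refl = ≈-refl ; sym = ≈-sym ; trans = ≈-trans }

  ≈-setoid : Setoid _ _
  ≈-setoid = record { isEquivalence = ≈-isEquivalence }

  module ≈-Reasoning = SetoidReasoning ≈-setoid

  ≡⇒≈ : ∀ {x y} → x ≡ y → x ≈ y
  ≡⇒≈ refl = ≈-refl

  +-cong : ∀ {x y u v} → x ≈ y → u ≈ v → x + u ≈ y + v
  +-cong {x} {y} {u} {v} (mk≈ p) (mk≈ q) = mk≈ (subst (+ n ∣_) (interchange x y u v) (∣m∣n⇒∣m+n p q))
    where
    interchange : ∀ x y u v → (x - y) + (u - v) ≡ (x + u) - (y + v)
    interchange = solve-∀

  +-congˡ : ∀ {x y} z → x ≈ y → z + x ≈ z + y
  +-congˡ z = +-cong (≈-refl {z})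

  +-congʳ : ∀ {x y} z → x ≈ y → x + z ≈ y + z
  +-congʳ z p = +-cong p ≈-refl

  *-congˡ : ∀ {x y} z → x ≈ y → z * x ≈ z * y
  *-congˡ {x} {y} z (mk≈ p) = mk≈ (subst (+ n ∣_) (distrib z x y) (∣n⇒∣m*n z p))
    where
    distrib : ∀ z x y → z * (x - y) ≡ z * x - z * y
    distrib = solve-∀

  *-congʳ : ∀ {x y} z → x ≈ y → x * z ≈ y * z
  *-congʳ {x} {y} z p = subst₂ _≈_ (ℤₚ.*-comm z x) (ℤₚ.*-comm z y) (*-congˡ z p)

  +-cancelˡ : ∀ z {x y} → z + x ≈ z + y → x ≈ y
  +-cancelˡ z {x} {y} (mk≈ p) = mk≈ (subst (+ n ∣_) (cancel z x y) p)
    where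
    cancel : ∀ z x y → (z + x) - (z + y) ≡ x - y
    cancel = solve-∀

  -‿cong : ∀ {x y} → x ≈ y → - x ≈ - y
  -‿cong {x} {y} (mk≈ p) = mk≈ (subst (+ n ∣_) (negate-difference x y) (∣m⇒∣-m p))
    where
    negate-difference : ∀ x y → - (x - y) ≡ - x - - y
    negate-difference = solve-∀

  multiple≈0 : ∀ q → q * + n ≈ + 0
  multiple≈0 q = mk≈ (divides q (ℤₚ.+-identityʳ (q * + n)))

  _≈±_ : ℤ → ℤ → Set
  x ≈± y = Σ ℤ λ σ → IsSign σ × x ≈ σ * y

  %ℕ-≈ : ∀ u → + (u ℤD.%ℕ n) ≈ u
  %ℕ-≈ u = ≈-sym (mk≈ (divides (u ℤD./ℕ n) (begin
    u - r                         ≡⟨ cong (_- r) (ℤD.a≡a%ℕn+[a/ℕn]*n u n) ⟩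
    r + u ℤD./ℕ n * + n - r       ≡⟨ cancel r (u ℤD./ℕ n * + n) ⟩
    u ℤD./ℕ n * + n               ∎)))
    where
    open ≡-Reasoning
    r : ℤ
    r = + (u ℤD.%ℕ n)
    cancel : ∀ a b → a + b - a ≡ b
    cancel = solve-∀

  %-≈ : ∀ c → + (c % n) ≈ + c
  %-≈ c = %ℕ-≈ (+ c)

  <-≈⇒≡ : ∀ {a b} → a ℕ.< n → b ℕ.< n → + a ≈ + b → a ≡ b
  <-≈⇒≡ {a} {b} a<n b<n (mk≈ n∣a-b) =
    ℤₚ.+-injective (ℤₚ.i-j≡0⇒i≡j (+ a) (+ b) (ℤₚ.∣i∣≡0⇒i≡0 ∣a-b∣≡0))
    where
    ∣a-b∣<n : ∣ + a - + b ∣ ℕ.< n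
    ∣a-b∣<n = subst (ℕ._< n) (cong ∣_∣ (sym (ℤₚ.m-n≡m⊖n a b)))
                (ℕₚ.≤-<-trans (ℤₚ.∣m⊝n∣≤m⊔n a b) (ℕₚ.⊔-pres-<m a<n b<n))
    below-multiple : ∀ d → d ℕ.< n → n ℕ∣.∣ d → d ≡ 0
    below-multiple zero    _   _   = refl
    below-multiple (suc d) d<n n∣d = contradiction n∣d (ℕ∣.>⇒∤ d<n)
    ∣a-b∣≡0 : ∣ + a - + b ∣ ≡ 0
    ∣a-b∣≡0 = below-multiple _ ∣a-b∣<n (∣⇒∣ᵤ n∣a-b)

  ≈⇒%≡ : ∀ {a b} → + a ≈ + b → a % n ≡ b % n
  ≈⇒%≡ {a} {b} a≈b =
    <-≈⇒≡ (ℕD.m%n<n a n) (ℕD.m%n<n b n) (≈-trans (%-≈ a) (≈-trans a≈b (≈-sym (%-≈ b))))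

  %≡⇒≈ : ∀ {a b} → a % n ≡ b % n → + a ≈ + b
  %≡⇒≈ {a} {b} eq = ≈-trans (≈-sym (%-≈ a)) (≈-trans (≡⇒≈ (cong +_ eq)) (%-≈ b))

  ⟦_⟧ : Fin n → ℤ
  ⟦ a ⟧ = + toℕ a

  ⟦⟧-injective : ∀ {a b} → ⟦ a ⟧ ≈ ⟦ b ⟧ → a ≡ b
  ⟦⟧-injective {a} {b} = Finₚ.toℕ-injective ∘ <-≈⇒≡ (Finₚ.toℕ<n a) (Finₚ.toℕ<n b)

  ⟦mod⟧ : ∀ c → ⟦ [ c ]mod n ⟧ ≈ + c
  ⟦mod⟧ c = ≈-trans (≡⇒≈ (cong +_ (Finₚ.toℕ-fromℕ< (ℕD.m%n<n c n)))) (%-≈ c)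

  ⟦+⟧ : ∀ a b → ⟦ _+ₙ_ n a b ⟧ ≈ ⟦ a ⟧ + ⟦ b ⟧
  ⟦+⟧ a b = ≈-trans (⟦mod⟧ (toℕ a ℕ.+ toℕ b)) (≡⇒≈ (ℤₚ.pos-+ (toℕ a) (toℕ b)))

  ⟦*⟧ : ∀ a b → ⟦ _*ₙ_ n a b ⟧ ≈ ⟦ a ⟧ * ⟦ b ⟧
  ⟦*⟧ a b = ≈-trans (⟦mod⟧ (toℕ a ℕ.* toℕ b)) (≡⇒≈ (ℤₚ.pos-* (toℕ a) (toℕ b)))

  ⟦-⟧ : ∀ a → ⟦ -ₙ_ n a ⟧ ≈ - ⟦ a ⟧
  ⟦-⟧ a = begin
    ⟦ -ₙ_ n a ⟧        ≈⟨ ⟦mod⟧ (n ℕ.∸ toℕ a) ⟩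
    + (n ℕ.∸ toℕ a)   ≡⟨ ℤₚ.⊖-≥ (ℕₚ.<⇒≤ (Finₚ.toℕ<n a)) ⟨
    n ⊖ toℕ a          ≡⟨ ℤₚ.m-n≡m⊖n n (toℕ a) ⟨
    + n - ⟦ a ⟧        ≡⟨ cong (_- ⟦ a ⟧) (ℤₚ.*-identityˡ (+ n)) ⟨
    + 1 * + n - ⟦ a ⟧  ≈⟨ +-congʳ (- ⟦ a ⟧) (multiple≈0 (+ 1)) ⟩
    + 0 - ⟦ a ⟧        ≡⟨ ℤₚ.+-identityˡ (- ⟦ a ⟧) ⟩
    - ⟦ a ⟧            ∎
    where open ≈-Reasoning

  ⊕-cancelʳ : ∀ {a b} c → a ⊕ c ≡ b ⊕ c → a ≡ b
  ⊕-cancelʳ {a} {b} c eq = ⟦⟧-injective (+-cancelˡ ⟦ c ⟧ (begin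
    ⟦ c ⟧ + ⟦ a ⟧  ≡⟨ ℤₚ.+-comm ⟦ c ⟧ ⟦ a ⟧ ⟩
    ⟦ a ⟧ + ⟦ c ⟧  ≈⟨ ⟦+⟧ a c ⟨
    ⟦ a ⊕ c ⟧      ≡⟨ cong ⟦_⟧ eq ⟩
    ⟦ b ⊕ c ⟧      ≈⟨ ⟦+⟧ b c ⟩
    ⟦ b ⟧ + ⟦ c ⟧  ≡⟨ ℤₚ.+-comm ⟦ b ⟧ ⟦ c ⟧ ⟩
    ⟦ c ⟧ + ⟦ b ⟧  ∎))
    where open ≈-Reasoning

  ⊕-swap : ∀ a b c → (a ⊕ b) ⊕ c ≡ (a ⊕ c) ⊕ b
  ⊕-swap a b c = ⟦⟧-injective (begin
    ⟦ (a ⊕ b) ⊕ c ⟧          ≈⟨ ⟦+⟧ (a ⊕ b) c ⟩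
    ⟦ a ⊕ b ⟧ + ⟦ c ⟧        ≈⟨ +-congʳ ⟦ c ⟧ (⟦+⟧ a b) ⟩
    ⟦ a ⟧ + ⟦ b ⟧ + ⟦ c ⟧    ≡⟨ swap ⟦ a ⟧ ⟦ b ⟧ ⟦ c ⟧ ⟩
    ⟦ a ⟧ + ⟦ c ⟧ + ⟦ b ⟧    ≈⟨ +-congʳ ⟦ b ⟧ (⟦+⟧ a c) ⟨
    ⟦ a ⊕ c ⟧ + ⟦ b ⟧        ≈⟨ ⟦+⟧ (a ⊕ c) b ⟨
    ⟦ (a ⊕ c) ⊕ b ⟧          ∎)
    where
    open ≈-Reasoning
    swap : ∀ a b c → a + b + c ≡ a + c + b
    swap = solve-∀

  ⊝-≈ : ∀ a b → ⟦ a ⊝ b ⟧ ≈ ⟦ a ⟧ - ⟦ b ⟧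
  ⊝-≈ a b = ≈-trans (⟦+⟧ a (-ₙ_ n b)) (+-congˡ ⟦ a ⟧ (⟦-⟧ b))

  ⊕-⊝ : ∀ a b → b ⊕ (a ⊝ b) ≡ a
  ⊕-⊝ a b = ⟦⟧-injective (begin
    ⟦ b ⊕ (a ⊝ b) ⟧        ≈⟨ ⟦+⟧ b (a ⊝ b) ⟩
    ⟦ b ⟧ + ⟦ a ⊝ b ⟧      ≈⟨ +-congˡ ⟦ b ⟧ (⊝-≈ a b) ⟩
    ⟦ b ⟧ + (⟦ a ⟧ - ⟦ b ⟧) ≡⟨ cancel ⟦ a ⟧ ⟦ b ⟧ ⟩
    ⟦ a ⟧                  ∎)
    where
    open ≈-Reasoning
    cancel : ∀ a b → b + (a - b) ≡ a
    cancel = solve-∀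

  bézout⇒inverse : ∀ {c} → Bézout.Identity 1 c n → Σ ℤ λ u → u * + c ≈ + 1
  bézout⇒inverse {c} (Bézout.+- x y eq) = + x , mk≈ (divides (+ y) (begin
    + x * + c - + 1           ≡⟨ cong (_- + 1) (ℤₚ.pos-* x c) ⟨
    + (x ℕ.* c) - + 1         ≡⟨ cong (λ z → + z - + 1) eq ⟨
    + (1 ℕ.+ y ℕ.* n) - + 1   ≡⟨⟩
    + (y ℕ.* n)               ≡⟨ ℤₚ.pos-* y n ⟩
    + y * + n                 ∎))
    where open ≡-Reasoning
  bézout⇒inverse {c} (Bézout.-+ x y eq) = - + x , mk≈ (divides (- + y) (begin
    - + x * + c - + 1         ≡⟨ negate (+ x) (+ c) ⟩
    - (+ 1 + + x * + c)       ≡⟨ cong (λ z → - (+ 1 + z)) (ℤₚ.pos-* x c) ⟨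
    - + (1 ℕ.+ x ℕ.* c)       ≡⟨ cong (λ z → - + z) eq ⟩
    - + (y ℕ.* n)             ≡⟨ cong -_ (ℤₚ.pos-* y n) ⟩
    - (+ y * + n)             ≡⟨ ℤₚ.neg-distribˡ-* (+ y) (+ n) ⟩
    - + y * + n               ∎))
    where
    open ≡-Reasoning
    negate : ∀ x c → - x * c - + 1 ≡ - (+ 1 + x * c)
    negate = solve-∀

  coprime⇒invertible : ∀ {c} → Coprime c n → Σ ℕ λ u → + u * + c ≈ + 1
  coprime⇒invertible {c} c⊥n = u ℤD.%ℕ n , ≈-trans (*-congʳ (+ c) (%ℕ-≈ u)) uc≈1
    where
    u : ℤ
    u = proj₁ (bézout⇒inverse (Coprime.coprime-Bézout c⊥n))
    uc≈1 : u * + c ≈ + 1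
    uc≈1 = proj₂ (bézout⇒inverse (Coprime.coprime-Bézout c⊥n))

  invertible-cancel : ∀ {u c x} → u * c ≈ + 1 → x * c ≈ + 0 → x ≈ + 0
  invertible-cancel {u} {c} {x} uc≈1 xc≈0 = begin
    x              ≡⟨ ℤₚ.*-identityʳ x ⟨
    x * + 1        ≈⟨ *-congˡ x uc≈1 ⟨
    x * (u * c)    ≡⟨ rearrange x u c ⟩
    u * (x * c)    ≈⟨ *-congˡ u xc≈0 ⟩
    u * + 0        ≡⟨ ℤₚ.*-zeroʳ u ⟩
    + 0            ∎
    where
    open ≈-Reasoning
    rearrange : ∀ x u c → x * (u * c) ≡ u * (x * c)
    rearrange = solve-∀

  2*unit≉0 : ∀ {u c} → 2 ℕ.< n → u * c ≈ + 1 → ¬ (+ 2 * c ≈ + 0)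
  2*unit≉0 {u} {c} 2<n uc≈1 2c≈0 =
    ℕₚ.1+n≢0 (<-≈⇒≡ {2} {0} 2<n (ℕₚ.<-trans ℕₚ.0<1+n 2<n) (invertible-cancel {u} {c} {+ 2} uc≈1 2c≈0))

  sign-unit-cancel : ∀ {σ τ P Q K L u} → IsSign σ → u * L ≈ + 1 →
    σ * + 2 * P ≈ τ * (+ 2 * K * u) * Q → + 2 * P * L ≈ σ * τ * (+ 2 * K * Q)
  sign-unit-cancel {σ} {τ} {P} {Q} {K} {L} {u} σ-sign uL≈1 eq = begin
    + 2 * P * L                          ≡⟨ ℤₚ.*-identityˡ (+ 2 * P * L) ⟨
    + 1 * (+ 2 * P * L)                  ≡⟨ cong (_* (+ 2 * P * L)) (sign*sign≡1 σ-sign) ⟨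
    σ * σ * (+ 2 * P * L)                ≡⟨ regroup₁ σ P L ⟩
    σ * L * (σ * + 2 * P)                ≈⟨ *-congˡ (σ * L) eq ⟩
    σ * L * (τ * (+ 2 * K * u) * Q)      ≡⟨ regroup₂ σ τ L K u Q ⟩
    σ * τ * (+ 2 * K * Q) * (u * L)      ≈⟨ *-congˡ (σ * τ * (+ 2 * K * Q)) uL≈1 ⟩
    σ * τ * (+ 2 * K * Q) * + 1          ≡⟨ ℤₚ.*-identityʳ (σ * τ * (+ 2 * K * Q)) ⟩
    σ * τ * (+ 2 * K * Q)                ∎
    where
    open ≈-Reasoning
    regroup₁ : ∀ σ P L → σ * σ * (+ 2 * P * L) ≡ σ * L * (σ * + 2 * P)
    regroup₁ = solve-∀
    regroup₂ : ∀ σ τ L K u Q → σ * L * (τ * (+ 2 * K * u) * Q) ≡ σ * τ * (+ 2 * K * Q) * (u * L)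
    regroup₂ = solve-∀

  no-return⇒same-sign : ∀ {a b c σ τ} K → IsSign σ → IsSign τ →
                        a ≈ b + σ * K → c ≈ a + τ * K → ¬ (c ≈ b) → c ≈ a + σ * K
  no-return⇒same-sign K (inj₁ refl) (inj₁ refl) _ c≈ _ = c≈
  no-return⇒same-sign K (inj₂ refl) (inj₂ refl) _ c≈ _ = c≈
  no-return⇒same-sign {a} {b} {c} K (inj₁ refl) (inj₂ refl) a≈ c≈ c≉b = contradiction (begin
    c                        ≈⟨ c≈ ⟩
    a + - + 1 * K            ≈⟨ +-congʳ (- + 1 * K) a≈ ⟩
    b + + 1 * K + - + 1 * K  ≡⟨ cancel b K ⟩
    b                        ∎) c≉b
    where
    open ≈-Reasoning
    cancel : ∀ b K → b + + 1 * K + - + 1 * K ≡ b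
    cancel = solve-∀
  no-return⇒same-sign {a} {b} {c} K (inj₂ refl) (inj₁ refl) a≈ c≈ c≉b = contradiction (begin
    c                        ≈⟨ c≈ ⟩
    a + + 1 * K              ≈⟨ +-congʳ (+ 1 * K) a≈ ⟩
    b + - + 1 * K + + 1 * K  ≡⟨ cancel b K ⟩
    b                        ∎) c≉b
    where
    open ≈-Reasoning
    cancel : ∀ b K → b + - + 1 * K + + 1 * K ≡ b
    cancel = solve-∀

  no-return⇒linear : ∀ (y : ℕ → ℤ) K → (∀ t → Σ ℤ λ σ → IsSign σ × y (suc t) ≈ y t + σ * K) →
                     (∀ t → ¬ (y (suc (suc t)) ≈ y t)) → Σ ℤ λ σ → IsSign σ × ∀ t → y t ≈ y 0 + σ * + t * K
  no-return⇒linear y K step no-return = σ , σ-sign , proj₁ ∘ linear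
    where
    σ : ℤ
    σ = proj₁ (step 0)
    σ-sign : IsSign σ
    σ-sign = proj₁ (proj₂ (step 0))
    linear : ∀ t → y t ≈ y 0 + σ * + t * K × y (suc t) ≈ y t + σ * K
    linear zero = ≡⇒≈ (no-steps (y 0) σ K) , proj₂ (proj₂ (step 0))
      where
      no-steps : ∀ y σ K → y ≡ y + σ * + 0 * K
      no-steps = solve-∀
    linear (suc t) = ≈-trans (proj₂ (linear t)) (≈-trans (+-congʳ (σ * K) (proj₁ (linear t)))
                       (≡⇒≈ (one-more (y 0) σ (+ t) K)))
                   , no-return⇒same-sign K σ-sign (proj₁ (proj₂ (step (suc t))))
                       (proj₂ (linear t)) (proj₂ (proj₂ (step (suc t)))) (no-return t)
      where
      one-more : ∀ y σ t K → y + σ * t * K + σ * K ≡ y + σ * (+ 1 + t) * K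
      one-more = solve-∀

  ±step⇒adjacent : ∀ {σ a b r} → IsSign σ → ⟦ b ⟧ ≈ ⟦ a ⟧ + σ * ⟦ r ⟧ →
                   b ≡ a ⊕ r ⊎ a ≡ b ⊕ r
  ±step⇒adjacent {a = a} {b} {r} (inj₁ refl) b≈ = inj₁ (⟦⟧-injective (begin
    ⟦ b ⟧                  ≈⟨ b≈ ⟩
    ⟦ a ⟧ + + 1 * ⟦ r ⟧    ≡⟨ cong (_+_ ⟦ a ⟧) (ℤₚ.*-identityˡ ⟦ r ⟧) ⟩
    ⟦ a ⟧ + ⟦ r ⟧          ≈⟨ ⟦+⟧ a r ⟨
    ⟦ a ⊕ r ⟧         ∎))
    where open ≈-Reasoning
  ±step⇒adjacent {a = a} {b} {r} (inj₂ refl) b≈ = inj₂ (⟦⟧-injective (begin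
    ⟦ a ⟧                          ≡⟨ cancel ⟦ a ⟧ ⟦ r ⟧ ⟩
    ⟦ a ⟧ + - + 1 * ⟦ r ⟧ + ⟦ r ⟧  ≈⟨ +-congʳ ⟦ r ⟧ b≈ ⟨
    ⟦ b ⟧ + ⟦ r ⟧                  ≈⟨ ⟦+⟧ b r ⟨
    ⟦ b ⊕ r ⟧                 ∎))
    where
    open ≈-Reasoning
    cancel : ∀ a r → a ≡ a + - + 1 * r + r
    cancel = solve-∀

  adjacent⇒±step : ∀ {a b r} → b ≡ a ⊕ r ⊎ a ≡ b ⊕ r →
                   Σ ℤ λ σ → IsSign σ × ⟦ b ⟧ ≈ ⟦ a ⟧ + σ * ⟦ r ⟧
  adjacent⇒±step {a} {b} {r} (inj₁ b≡a+r) = + 1 , inj₁ refl , (begin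
    ⟦ b ⟧                  ≡⟨ cong ⟦_⟧ b≡a+r ⟩
    ⟦ a ⊕ r ⟧         ≈⟨ ⟦+⟧ a r ⟩
    ⟦ a ⟧ + ⟦ r ⟧          ≡⟨ cong (_+_ ⟦ a ⟧) (ℤₚ.*-identityˡ ⟦ r ⟧) ⟨
    ⟦ a ⟧ + + 1 * ⟦ r ⟧    ∎)
    where open ≈-Reasoning
  adjacent⇒±step {a} {b} {r} (inj₂ a≡b+r) = - + 1 , inj₂ refl , (begin
    ⟦ b ⟧                           ≡⟨ cancel ⟦ b ⟧ ⟦ r ⟧ ⟩
    ⟦ b ⟧ + ⟦ r ⟧ + - + 1 * ⟦ r ⟧   ≈⟨ +-congʳ (- + 1 * ⟦ r ⟧) (⟦+⟧ b r) ⟨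
    ⟦ b ⊕ r ⟧ + - + 1 * ⟦ r ⟧  ≡⟨ cong (λ c → ⟦ c ⟧ + - + 1 * ⟦ r ⟧) a≡b+r ⟨
    ⟦ a ⟧ + - + 1 * ⟦ r ⟧           ∎)
    where
    open ≈-Reasoning
    cancel : ∀ b r → b ≡ b + r + - + 1 * r
    cancel = solve-∀

  ≈±-refl : ∀ {x} → x ≈± x
  ≈±-refl {x} = + 1 , inj₁ refl , ≡⇒≈ (sym (ℤₚ.*-identityˡ x))

  ≈⇒≈± : ∀ {x y} → x ≈ y → x ≈± y
  ≈⇒≈± {y = y} x≈y = + 1 , inj₁ refl , ≈-trans x≈y (≡⇒≈ (sym (ℤₚ.*-identityˡ y)))

  ≈±-reflexive : ∀ {x y} → x ≡ y → x ≈± y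
  ≈±-reflexive refl = ≈±-refl

  ≈±-sym : ∀ {x y} → x ≈± y → y ≈± x
  ≈±-sym {x} {y} (σ , σ-sign , x≈σy) = σ , σ-sign , ≈-sym (begin
    σ * x        ≈⟨ *-congˡ σ x≈σy ⟩
    σ * (σ * y)  ≡⟨ ℤₚ.*-assoc σ σ y ⟨
    σ * σ * y    ≡⟨ cong (_* y) (sign*sign≡1 σ-sign) ⟩
    + 1 * y      ≡⟨ ℤₚ.*-identityˡ y ⟩
    y            ∎)
    where open ≈-Reasoning

  ≈±-trans : ∀ {x y z} → x ≈± y → y ≈± z → x ≈± z
  ≈±-trans {x} {y} {z} (σ , σ-sign , x≈σy) (τ , τ-sign , y≈τz) =
    σ * τ , sign-* σ-sign τ-sign ,
    ≈-trans x≈σy (≈-trans (*-congˡ σ y≈τz) (≡⇒≈ (sym (ℤₚ.*-assoc σ τ z))))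

  ≈±-*-cong : ∀ {x y u v} → x ≈± y → u ≈± v → x * u ≈± y * v
  ≈±-*-cong {x} {y} {u} {v} (σ , σ-sign , x≈σy) (τ , τ-sign , u≈τv) = σ * τ , sign-* σ-sign τ-sign , (begin
    x * u              ≈⟨ *-congʳ u x≈σy ⟩
    σ * y * u          ≈⟨ *-congˡ (σ * y) u≈τv ⟩
    σ * y * (τ * v)    ≡⟨ regroup σ τ y v ⟩
    σ * τ * (y * v)    ∎)
    where
    open ≈-Reasoning
    regroup : ∀ σ τ y v → σ * y * (τ * v) ≡ σ * τ * (y * v)
    regroup = solve-∀

  ≈±1-^ : ∀ {x} → x ≈± + 1 → ∀ t → x ^ t ≈± + 1
  ≈±1-^ x≈±1 zero    = ≈±-refl
  ≈±1-^ x≈±1 (suc t) = ≈±-trans (≈±-*-cong x≈±1 (≈±1-^ x≈±1 t)) (≈±-reflexive (ℤₚ.*-identityˡ (+ 1)))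

  _≈?_ : ∀ x y → Dec (x ≈ y)
  x ≈? y = map′ mk≈ n∣x-y (+ n ∣? x - y)

  _≈±?_ : ∀ x y → Dec (x ≈± y)
  x ≈±? y with x ≈? y | x ≈? - y
  ... | yes x≈y | _ = yes (+ 1 , inj₁ refl , ≈-trans x≈y (≡⇒≈ (sym (ℤₚ.*-identityˡ y))))
  ... | no _ | yes x≈-y = yes (- + 1 , inj₂ refl , ≈-trans x≈-y (≡⇒≈ (sym (ℤₚ.-1*i≡-i y))))
  ... | no x≉y | no x≉-y = no λ where
    (_ , inj₁ refl , x≈y)  → x≉y (≈-trans x≈y (≡⇒≈ (ℤₚ.*-identityˡ y)))
    (_ , inj₂ refl , x≈-y) → x≉-y (≈-trans x≈-y (≡⇒≈ (ℤₚ.-1*i≡-i y)))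

module _ {d n : ℕ} .{{_ : NonZero d}} .{{_ : NonZero n}} where
  private
    module D = Modular d
    module N = Modular n

  ≈-weaken : d ℕ∣.∣ n → ∀ {x y} → x N.≈ y → x D.≈ y
  ≈-weaken d∣n (N.mk≈ n∣x-y) = D.mk≈ (∣-trans (∣ᵤ⇒∣ d∣n) n∣x-y)

module Parity where
  open Modular 2 public

  x+x≈0 : ∀ x → x + x ≈ + 0
  x+x≈0 x = ≈-trans (≡⇒≈ (double x)) (multiple≈0 x)
    where
    double : ∀ x → x + x ≡ x * + 2
    double = solve-∀

  1≉0 : ¬ (+ 1 ≈ + 0)
  1≉0 = ℕₚ.1+n≢0 ∘ ≈⇒%≡

toℕ-[]mod : ∀ {m} .{{_ : NonZero m}} c → c ℕ.< m → toℕ ([ c ]mod m) ≡ c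
toℕ-[]mod {m} c c<m = trans (Finₚ.toℕ-fromℕ< (ℕD.m%n<n c m)) (ℕD.m<n⇒m%n≡m c<m)

toℕ-[m]mod : ∀ {m} .{{_ : NonZero m}} → toℕ ([ m ]mod m) ≡ 0
toℕ-[m]mod {m} = trans (Finₚ.toℕ-fromℕ< (ℕD.m%n<n m m)) (ℕD.n%n≡0 m)

<2⇒≡0⊎≡1 : ∀ {r} → r ℕ.< 2 → r ≡ 0 ⊎ r ≡ 1
<2⇒≡0⊎≡1 {0}           _                   = inj₁ refl
<2⇒≡0⊎≡1 {1}           _                   = inj₂ refl
<2⇒≡0⊎≡1 {suc (suc _)} (ℕ.s≤s (ℕ.s≤s ()))

%2≡0⊎%2≡1 : ∀ t → t % 2 ≡ 0 ⊎ t % 2 ≡ 1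
%2≡0⊎%2≡1 t = <2⇒≡0⊎≡1 (ℕD.m%n<n t 2)

x%2≢[1+x]%2 : ∀ x → x % 2 ≢ suc x % 2
x%2≢[1+x]%2 x eq = Parity.1≉0 (begin
  + 1                ≡⟨ ℤₚ.+-identityʳ (+ 1) ⟨
  + 1 + + 0          ≈⟨ +-congˡ (+ 1) (Parity.x+x≈0 (+ x)) ⟨
  + 1 + (+ x + + x)  ≡⟨ ℤₚ.+-assoc (+ 1) (+ x) (+ x) ⟨
  + suc x + + x      ≈⟨ +-congʳ (+ x) (%≡⇒≈ eq) ⟨
  + x + + x          ≈⟨ Parity.x+x≈0 (+ x) ⟩
  + 0                ∎)
  where open Parity; open ≈-Reasoning

%2-binary : ∀ a b c → a % 2 ≢ c % 2 → b % 2 ≢ a % 2 → b % 2 ≡ c % 2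
%2-binary a b c a≁c b≁a with %2≡0⊎%2≡1 a | %2≡0⊎%2≡1 b | %2≡0⊎%2≡1 c
... | _       | inj₁ b0 | inj₁ c0 = trans b0 (sym c0)
... | _       | inj₂ b1 | inj₂ c1 = trans b1 (sym c1)
... | inj₁ a0 | inj₁ b0 | inj₂ _  = contradiction (trans b0 (sym a0)) b≁a
... | inj₂ a1 | inj₁ _  | inj₂ c1 = contradiction (trans a1 (sym c1)) a≁c
... | inj₁ a0 | inj₂ _  | inj₁ c0 = contradiction (trans a0 (sym c0)) a≁c
... | inj₂ a1 | inj₂ b1 | inj₁ _  = contradiction (trans b1 (sym a1)) b≁a

module Cyclic (m : ℕ) .{{_ : NonZero m}} where

  open Modular m

  next : Fin m → Fin m
  next i = [ suc (toℕ i) ]mod m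

  toℕ-next : ∀ i → suc (toℕ i) ℕ.< m → toℕ (next i) ≡ suc (toℕ i)
  toℕ-next i = toℕ-[]mod (suc (toℕ i))

  toℕ-next-last : ∀ i → suc (toℕ i) ≡ m → toℕ (next i) ≡ 0
  toℕ-next-last i eq = trans (cong (λ c → toℕ ([ c ]mod m)) eq) toℕ-[m]mod

  next-injective : ∀ {i j} → next i ≡ next j → i ≡ j
  next-injective {i} {j} eq = ⟦⟧-injective (+-cancelˡ (+ 1) (begin
    + 1 + ⟦ i ⟧    ≈⟨ ⟦mod⟧ (suc (toℕ i)) ⟨
    ⟦ next i ⟧     ≡⟨ cong ⟦_⟧ eq ⟩
    ⟦ next j ⟧     ≈⟨ ⟦mod⟧ (suc (toℕ j)) ⟩
    + 1 + ⟦ j ⟧    ∎))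
    where open ≈-Reasoning

  next≢ : 2 ℕ.≤ m → ∀ i → next i ≢ i
  next≢ 2≤m i eq with ℕₚ.<-cmp (suc (toℕ i)) m
  ... | tri< i+1<m _ _ = ℕₚ.1+n≢n (trans (sym (toℕ-next i i+1<m)) (cong toℕ eq))
  ... | tri≈ _ i+1≡m _ = ℕₚ.<⇒≢ 2≤m (trans (cong suc (sym i≡0)) i+1≡m)
    where
    i≡0 : toℕ i ≡ 0
    i≡0 = trans (cong toℕ (sym eq)) (toℕ-next-last i i+1≡m)
  ... | tri> _ _ i+1>m = ℕₚ.<⇒≱ (Finₚ.toℕ<n i) (ℕₚ.≤-pred i+1>m)

  index : ℕ → Fin m
  index t = [ t ]mod m

  0ₘ 1ₘ : Fin m
  0ₘ = index 0
  1ₘ = next 0ₘ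

  toℕ-0ₘ : toℕ 0ₘ ≡ 0
  toℕ-0ₘ = toℕ-[]mod 0 (ℕ.>-nonZero⁻¹ m)

  next-index : ∀ t → next (index t) ≡ index (suc t)
  next-index t = ⟦⟧-injective (begin
    ⟦ next (index t) ⟧   ≈⟨ ⟦mod⟧ (suc (toℕ (index t))) ⟩
    + 1 + ⟦ index t ⟧    ≈⟨ +-congˡ (+ 1) (⟦mod⟧ t) ⟩
    + suc t              ≈⟨ ⟦mod⟧ (suc t) ⟨
    ⟦ index (suc t) ⟧    ∎)
    where open ≈-Reasoning

  index-toℕ : ∀ i → index (toℕ i) ≡ i
  index-toℕ i = ⟦⟧-injective (⟦mod⟧ (toℕ i))

  index-m : index m ≡ 0ₘ
  index-m = ⟦⟧-injective (begin
    ⟦ index m ⟧   ≈⟨ ⟦mod⟧ m ⟩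
    + m           ≡⟨ ℤₚ.*-identityˡ (+ m) ⟨
    + 1 * + m     ≈⟨ multiple≈0 (+ 1) ⟩
    + 0           ≈⟨ ⟦mod⟧ 0 ⟨
    ⟦ 0ₘ ⟧        ∎)
    where open ≈-Reasoning

module XaStructure (m n : ℕ) .{{_ : NonZero m}} .{{_ : NonZero n}}
  (2≤m : 2 ℕ.≤ m) (n-even : n % 2 ≡ 0)
  (k : Fin m → Fin n) (ℓ : Fin n) (ℓ-parity : toℕ ℓ % 2 ≡ m % 2) where

  open Modular n
  open Cyclic m
  private
    module ₂ = Parity

  E X : Vertex m n → Vertex m n → Set
  E = XaEdge m n k ℓ
  X = Xa m n k ℓ

  ≈⇒≈₂ : ∀ {x y} → x ≈ y → x ₂.≈ y
  ≈⇒≈₂ = ≈-weaken (ℕ∣.m%n≡0⇒n∣m n 2 n-even)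

  ⊕-even-parity : ∀ a e → ⟦ e ⟧ ₂.≈ + 0 → toℕ (a ⊕ e) % 2 ≡ toℕ a % 2
  ⊕-even-parity a e e≈0 = ₂.≈⇒%≡ (begin
    ⟦ a ⊕ e ⟧      ≈⟨ ≈⇒≈₂ (⟦+⟧ a e) ⟩
    ⟦ a ⟧ + ⟦ e ⟧  ≈⟨ ₂.+-congˡ ⟦ a ⟧ e≈0 ⟩
    ⟦ a ⟧ + + 0    ≡⟨ ℤₚ.+-identityʳ ⟦ a ⟧ ⟩
    ⟦ a ⟧          ∎)
    where open ₂.≈-Reasoning

  data Up (i : Fin m) (a : Fin n) (j : Fin m) (b : Fin n) : Set where
    rung : toℕ a % 2 ≡ toℕ i % 2 → suc (toℕ i) ℕ.< m → j ≡ next i → b ≡ a → Up i a j b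
    wrap : toℕ a % 2 ≡ toℕ i % 2 → suc (toℕ i) ≡ m → j ≡ next i → b ≡ a ⊕ ℓ → Up i a j b

  CrossEdge : Fin m → Fin n → Fin m → Fin n → Set
  CrossEdge i a j b = Up i a j b ⊎ Up j b i a

  up-≢ : ∀ {i a j b} → Up i a j b → i ≢ j
  up-≢ (rung _ _ refl _) eq = next≢ 2≤m _ (sym eq)
  up-≢ (wrap _ _ refl _) eq = next≢ 2≤m _ (sym eq)

  up-source-parity : ∀ {i a j b} → Up i a j b → toℕ a % 2 ≡ toℕ i % 2
  up-source-parity (rung a~i _ _ _) = a~i
  up-source-parity (wrap a~i _ _ _) = a~i

  up-target-parity : ∀ {i a j b} → Up i a j b → toℕ b % 2 ≢ toℕ j % 2
  up-target-parity {i} (rung a~i i+1<m refl refl) b~j =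
    x%2≢[1+x]%2 (toℕ i) (trans (sym a~i) (trans b~j (cong (_% 2) (toℕ-next i i+1<m))))
  up-target-parity {i} {a} (wrap a~i i+1≡m refl refl) b~j = ₂.1≉0 (begin
    + 1                         ≈⟨ ₂.+-congʳ (+ 1) (₂.x+x≈0 (+ toℕ i)) ⟨
    + toℕ i + + toℕ i + + 1     ≡⟨ ℤₚ.+-assoc (+ toℕ i) (+ toℕ i) (+ 1) ⟩
    + toℕ i + + (toℕ i ℕ.+ 1)   ≡⟨ cong (λ x → + toℕ i + + x) (trans (ℕₚ.+-comm (toℕ i) 1) i+1≡m) ⟩
    + toℕ i + + m               ≈⟨ ₂.+-cong (₂.%≡⇒≈ {toℕ a} {toℕ i} a~i) (₂.%≡⇒≈ {toℕ ℓ} {m} ℓ-parity) ⟨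
    ⟦ a ⟧ + ⟦ ℓ ⟧               ≈⟨ ≈⇒≈₂ (⟦+⟧ a ℓ) ⟨
    ⟦ a ⊕ ℓ ⟧                   ≈⟨ ₂.%≡⇒≈ b~j ⟩
    + toℕ (next i)              ≡⟨ cong +_ (toℕ-next-last i i+1≡m) ⟩
    + 0                         ∎)
    where open ₂.≈-Reasoning

  up-unique : ∀ {i a j b j′ b′} → Up i a j b → Up i a j′ b′ → j ≡ j′ × b ≡ b′
  up-unique (rung _ _ refl refl) (rung _ _ refl refl) = refl , refl
  up-unique (wrap _ _ refl refl) (wrap _ _ refl refl) = refl , refl
  up-unique (rung _ i+1<m _ _) (wrap _ i+1≡m _ _) = ⊥-elim (ℕₚ.<⇒≢ i+1<m i+1≡m)
  up-unique (wrap _ i+1≡m _ _) (rung _ i+1<m _ _) = ⊥-elim (ℕₚ.<⇒≢ i+1<m i+1≡m)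

  down-unique : ∀ {i a j b j′ b′} → Up j b i a → Up j′ b′ i a → j ≡ j′ × b ≡ b′
  down-unique (rung _ _ i≡ refl) (rung _ _ i≡′ refl) = next-injective (trans (sym i≡) i≡′) , refl
  down-unique (wrap _ j+1≡m _ a≡) (wrap _ j′+1≡m _ a≡′) =
    Finₚ.toℕ-injective (ℕₚ.suc-injective (trans j+1≡m (sym j′+1≡m))) , ⊕-cancelʳ ℓ (trans (sym a≡) a≡′)
  down-unique {j = j} {j′ = j′} (rung _ j+1<m i≡ _) (wrap _ j′+1≡m i≡′ _) = ⊥-elim (ℕₚ.0≢1+n (begin
    0                ≡⟨ toℕ-next-last j′ j′+1≡m ⟨
    toℕ (next j′)    ≡⟨ cong toℕ (trans (sym i≡′) i≡) ⟩
    toℕ (next j)     ≡⟨ toℕ-next j j+1<m ⟩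
    suc (toℕ j)      ∎))
    where open ≡-Reasoning
  down-unique {j = j} {j′ = j′} (wrap _ j+1≡m i≡ _) (rung _ j′+1<m i≡′ _) = ⊥-elim (ℕₚ.0≢1+n (begin
    0                ≡⟨ toℕ-next-last j j+1≡m ⟨
    toℕ (next j)     ≡⟨ cong toℕ (trans (sym i≡) i≡′) ⟩
    toℕ (next j′)    ≡⟨ toℕ-next j′ j′+1<m ⟩
    suc (toℕ j′)     ∎))
    where open ≡-Reasoning

  cross-unique : ∀ {i a j b j′ b′} → CrossEdge i a j b → CrossEdge i a j′ b′ → j ≡ j′ × b ≡ b′
  cross-unique (inj₁ u) (inj₁ u′) = up-unique u u′
  cross-unique (inj₂ d) (inj₂ d′) = down-unique d d′
  cross-unique (inj₁ u) (inj₂ d)  = ⊥-elim (up-target-parity d (up-source-parity u))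
  cross-unique (inj₂ d) (inj₁ u)  = ⊥-elim (up-target-parity d (up-source-parity u))

  up⇒edge : ∀ {i a j b} → Up i a j b → E (i , a) (j , b)
  up⇒edge (rung a~i i+1<m refl refl) = rung _ _ i+1<m a~i
  up⇒edge (wrap a~i i+1≡m refl refl) = wrap _ _ i+1≡m a~i

  [_]mod-parity : ∀ c → toℕ ([ c ]mod n) % 2 ≡ c % 2
  [ c ]mod-parity = ₂.≈⇒%≡ {toℕ ([ c ]mod n)} (≈⇒≈₂ (⟦mod⟧ c))

  up-from : ∀ i → Σ (Fin n) (Up i ([ toℕ i ]mod n) (next i))
  up-from i with ℕₚ.<-cmp (suc (toℕ i)) m
  ... | tri< i+1<m _ _ = _ , rung [ toℕ i ]mod-parity i+1<m refl refl
  ... | tri≈ _ i+1≡m _ = _ , wrap [ toℕ i ]mod-parity i+1≡m refl refl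
  ... | tri> _ _ i+1>m = ⊥-elim (ℕₚ.<⇒≱ (Finₚ.toℕ<n i) (ℕₚ.≤-pred i+1>m))

  edge-shape : ∀ {i a j b} → E (i , a) (j , b) → (i ≡ j × b ≡ a ⊕ k i) ⊎ Up i a j b
  edge-shape (cyc i a)            = inj₁ (refl , refl)
  edge-shape (rung i a i+1<m a~i) = inj₂ (rung a~i i+1<m refl refl)
  edge-shape (wrap i a i+1≡m a~i) = inj₂ (wrap a~i i+1≡m refl refl)

  cycle-edge : ∀ {i a b} → X (i , a) (i , b) → b ≡ a ⊕ k i ⊎ a ≡ b ⊕ k i
  cycle-edge (inj₁ e) with edge-shape e
  ... | inj₁ (_ , b≡) = inj₁ b≡
  ... | inj₂ u        = ⊥-elim (up-≢ u refl)
  cycle-edge (inj₂ e) with edge-shape e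
  ... | inj₁ (_ , a≡) = inj₂ a≡
  ... | inj₂ u        = ⊥-elim (up-≢ u refl)

  cross-edge : ∀ {i a j b} → i ≢ j → X (i , a) (j , b) → CrossEdge i a j b
  cross-edge i≢j (inj₁ e) with edge-shape e
  ... | inj₁ (i≡j , _) = contradiction i≡j i≢j
  ... | inj₂ u         = inj₁ u
  cross-edge i≢j (inj₂ e) with edge-shape e
  ... | inj₁ (j≡i , _) = ⊥-elim (i≢j (sym j≡i))
  ... | inj₂ u         = inj₂ u

  translate-edge : ∀ {i a j b} e → ⟦ e ⟧ ₂.≈ + 0 → E (i , a) (j , b) → E (i , a ⊕ e) (j , b ⊕ e)
  translate-edge e e≈0 (cyc i a) = subst (λ b → E (i , a ⊕ e) (i , b)) (⊕-swap a e (k i)) (cyc i (a ⊕ e))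
  translate-edge e e≈0 (rung i a i+1<m a~i) = rung i (a ⊕ e) i+1<m (trans (⊕-even-parity a e e≈0) a~i)
  translate-edge e e≈0 (wrap i a i+1≡m a~i) = subst (λ b → E (i , a ⊕ e) (next i , b)) (⊕-swap a e ℓ)
    (wrap i (a ⊕ e) i+1≡m (trans (⊕-even-parity a e e≈0) a~i))

  translate : ∀ {i a j b} e → ⟦ e ⟧ ₂.≈ + 0 → X (i , a) (j , b) → X (i , a ⊕ e) (j , b ⊕ e)
  translate e e≈0 (inj₁ ab) = inj₁ (translate-edge e e≈0 ab)
  translate e e≈0 (inj₂ ba) = inj₂ (translate-edge e e≈0 ba)

  cycle-step : ∀ {i a b} → X (i , a) (i , b) → Σ ℤ λ σ → IsSign σ × ⟦ b ⟧ ≈ ⟦ a ⟧ + σ * ⟦ k i ⟧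
  cycle-step = adjacent⇒±step ∘ cycle-edge

module LayerPreservingAutomorphisms (m n : ℕ) .{{_ : NonZero m}} .{{_ : NonZero n}}
  (2≤m : 2 ℕ.≤ m) (2<n : 2 ℕ.< n) (n-even : n % 2 ≡ 0)
  (k : Fin m → Fin n) (ℓ : Fin n) (ℓ-parity : toℕ ℓ % 2 ≡ m % 2)
  (k-coprime : ∀ i → Coprime (toℕ (k i)) n)
  (G : (Vertex m n → Vertex m n) → Set) (G≤Aut : IsAutSubgroup (Xa m n k ℓ) G)
  (G-preserves : Preserves𝒞 G) where

  open Modular n
  open Cyclic m
  open XaStructure m n 2≤m n-even k ℓ ℓ-parity
  open IsAutSubgroup G≤Aut

  layer : ∀ {g} → G g → Fin m → Fin m
  layer g∈G i = proj₁ (G-preserves _ g∈G i)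

  position : (Vertex m n → Vertex m n) → Fin m → Fin n → Fin n
  position g i a = proj₂ (g (i , a))

  image : ∀ {g} (g∈G : G g) i a → g (i , a) ≡ (layer g∈G i , position g i a)
  image {g} g∈G i a = cong (_, position g i a) (proj₂ (G-preserves _ g∈G i) a)

  map-edge : ∀ {g} (g∈G : G g) {i a j b} → X (i , a) (j , b) →
             X (layer g∈G i , position g i a) (layer g∈G j , position g j b)
  map-edge g∈G {i} {a} {j} {b} e =
    subst₂ X (image g∈G i a) (image g∈G j b) (Equivalence.to (proj₂ (aut g∈G) _ _) e)

  layer-injective : ∀ {g} (g∈G : G g) {i j} → layer g∈G i ≡ layer g∈G j → i ≡ j
  layer-injective {g} g∈G {i} {j} eq with invG g∈G
  ... | h , h∈G , hg≡id , _ = trans (sym (back i)) (trans (cong (layer h∈G) eq) (back j))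
    where
    o : Fin n
    o = [ 0 ]mod n
    back : ∀ i → layer h∈G (layer g∈G i) ≡ i
    back i = begin
      layer h∈G (layer g∈G i)                  ≡⟨ proj₂ (G-preserves _ h∈G (layer g∈G i)) (position g i o) ⟨
      proj₁ (h (layer g∈G i , position g i o)) ≡⟨ cong (proj₁ ∘ h) (image g∈G i o) ⟨
      proj₁ (h (g (i , o)))                    ≡⟨ cong proj₁ (hg≡id (i , o)) ⟩
      i                                        ∎
      where open ≡-Reasoning

  position-injective : ∀ {g} (g∈G : G g) i {a b} → position g i a ≡ position g i b → a ≡ b
  position-injective g∈G i {a} {b} eq = cong proj₂ (proj₁ (proj₁ (aut g∈G))
    (trans (image g∈G i a) (trans (cong (layer g∈G i ,_) eq) (sym (image g∈G i b)))))

  walk : Fin m → Fin n → ℕ → Fin n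
  walk i x t = [ toℕ x ℕ.+ t ℕ.* toℕ (k i) ]mod n

  walk-≈ : ∀ i x t → ⟦ walk i x t ⟧ ≈ ⟦ x ⟧ + + t * ⟦ k i ⟧
  walk-≈ i x t = ≈-trans (⟦mod⟧ _)
    (≡⇒≈ (trans (ℤₚ.pos-+ (toℕ x) _) (cong (_+_ ⟦ x ⟧) (ℤₚ.pos-* t (toℕ (k i))))))

  on-walk : ∀ i x {p} t → ⟦ p ⟧ ≈ ⟦ x ⟧ + + t * ⟦ k i ⟧ → p ≡ walk i x t
  on-walk i x t p≈ = ⟦⟧-injective (≈-trans p≈ (≈-sym (walk-≈ i x t)))

  walk-next : ∀ i x t → walk i x t ⊕ k i ≡ walk i x (suc t)
  walk-next i x t = on-walk i x (suc t) (begin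
    ⟦ walk i x t ⊕ k i ⟧               ≈⟨ ⟦+⟧ (walk i x t) (k i) ⟩
    ⟦ walk i x t ⟧ + ⟦ k i ⟧           ≈⟨ +-congʳ ⟦ k i ⟧ (walk-≈ i x t) ⟩
    ⟦ x ⟧ + + t * ⟦ k i ⟧ + ⟦ k i ⟧    ≡⟨ one-more ⟦ x ⟧ (+ t) ⟦ k i ⟧ ⟩
    ⟦ x ⟧ + + suc t * ⟦ k i ⟧          ∎)
    where
    open ≈-Reasoning
    one-more : ∀ x t K → x + t * K + K ≡ x + (+ 1 + t) * K
    one-more = solve-∀

  -- 2k_i ≢ 0 (mod n) since k_i is a unit and n > 2.
  walk-no-return : ∀ i x t → walk i x (2 ℕ.+ t) ≢ walk i x t
  walk-no-return i x t eq = 2*unit≉0 {+ proj₁ k⁻¹} {K} 2<n (proj₂ k⁻¹) (+-cancelˡ ⟦ walk i x t ⟧ (begin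
    ⟦ walk i x t ⟧ + + 2 * K        ≈⟨ +-congʳ (+ 2 * K) (walk-≈ i x t) ⟩
    ⟦ x ⟧ + + t * K + + 2 * K       ≡⟨ two-more ⟦ x ⟧ (+ t) K ⟩
    ⟦ x ⟧ + + (2 ℕ.+ t) * K         ≈⟨ walk-≈ i x (2 ℕ.+ t) ⟨
    ⟦ walk i x (2 ℕ.+ t) ⟧          ≡⟨ cong ⟦_⟧ eq ⟩
    ⟦ walk i x t ⟧                  ≡⟨ ℤₚ.+-identityʳ ⟦ walk i x t ⟧ ⟨
    ⟦ walk i x t ⟧ + + 0            ∎))
    where
    open ≈-Reasoning
    K : ℤ
    K = ⟦ k i ⟧
    k⁻¹ : Σ ℕ λ u → + u * K ≈ + 1
    k⁻¹ = coprime⇒invertible (k-coprime i)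
    two-more : ∀ x t K → x + t * K + + 2 * K ≡ x + (+ 2 + t) * K
    two-more = solve-∀

  along-cycle : ∀ {g} (g∈G : G g) i x → Σ ℤ λ σ → IsSign σ ×
    (∀ t p → ⟦ p ⟧ ≈ ⟦ x ⟧ + + t * ⟦ k i ⟧ →
             ⟦ position g i p ⟧ ≈ ⟦ position g i x ⟧ + σ * + t * ⟦ k (layer g∈G i) ⟧)
  along-cycle {g} g∈G i x = σ , σ-sign , λ t p p≈ →
    subst₂ (λ a b → ⟦ position g i a ⟧ ≈ ⟦ position g i b ⟧ + σ * + t * K′)
      (sym (on-walk i x t p≈)) (sym (on-walk i x 0 (≡⇒≈ (zero-steps ⟦ x ⟧ ⟦ k i ⟧)))) (linear t)
    where
    K′ : ℤ
    K′ = ⟦ k (layer g∈G i) ⟧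

    zero-steps : ∀ x K → x ≡ x + + 0 * K
    zero-steps = solve-∀

    y : ℕ → ℤ
    y t = ⟦ position g i (walk i x t) ⟧

    step : ∀ t → Σ ℤ λ σ → IsSign σ × y (suc t) ≈ y t + σ * K′
    step t = cycle-step (map-edge g∈G (inj₁
      (subst (λ b → E (i , walk i x t) (i , b)) (walk-next i x t) (cyc i (walk i x t)))))

    no-return : ∀ t → ¬ (y (suc (suc t)) ≈ y t)
    no-return t = walk-no-return i x t ∘ position-injective g∈G i ∘ ⟦⟧-injective

    σ : ℤ
    σ = proj₁ (no-return⇒linear y K′ step no-return)
    σ-sign : IsSign σ
    σ-sign = proj₁ (proj₂ (no-return⇒linear y K′ step no-return))
    linear : ∀ t → y t ≈ y 0 + σ * + t * K′
    linear = proj₂ (proj₂ (no-return⇒linear y K′ step no-return))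

  -- Both translation by an even element and g preserve cross edges, and a vertex has only one
  -- cross neighbour, so g moves the two ends of a translated cross edge by the same amount.
  cross-displacement : ∀ {g} (g∈G : G g) {i x j y} e → i ≢ j → X (i , x) (j , y) → ⟦ e ⟧ Parity.≈ + 0 →
    ⟦ position g i (x ⊕ e) ⊝ position g i x ⟧ Parity.≈ + 0 →
    position g j (y ⊕ e) ≡ position g j y ⊕ (position g i (x ⊕ e) ⊝ position g i x)
  cross-displacement {g} g∈G {i} {x} {j} {y} e i≢j xy e-even δ-even = proj₂ (cross-unique
    (cross-edge Lᵢ≢Lⱼ (map-edge g∈G (translate e e-even xy)))
    (subst (λ a → CrossEdge (layer g∈G i) a (layer g∈G j) (y′ ⊕ δ)) (⊕-⊝ x″ x′)
      (cross-edge Lᵢ≢Lⱼ (translate δ δ-even (map-edge g∈G xy)))))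
    where
    x′ x″ y′ δ : Fin n
    x′ = position g i x
    x″ = position g i (x ⊕ e)
    y′ = position g j y
    δ  = x″ ⊝ x′
    Lᵢ≢Lⱼ : layer g∈G i ≢ layer g∈G j
    Lᵢ≢Lⱼ = i≢j ∘ layer-injective g∈G

  translation-congruence : ∀ {g} (g∈G : G g) {i x j y} → i ≢ j → X (i , x) (j , y) →
    ∀ s t → s % 2 ≡ 0 → + s * ⟦ k i ⟧ ≈ + t * ⟦ k j ⟧ →
    proj₁ (along-cycle g∈G i x) * + s * ⟦ k (layer g∈G i) ⟧ ≈
    proj₁ (along-cycle g∈G j y) * + t * ⟦ k (layer g∈G j) ⟧
  translation-congruence {g} g∈G {i} {x} {j} {y} i≢j xy s t s-even sKᵢ≈tKⱼ = begin
    σ₁ * + s * Pᵢ                        ≈⟨ δ≈ ⟨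
    ⟦ δ ⟧                                ≡⟨ cancel ⟦ y′ ⟧ ⟦ δ ⟧ ⟨
    ⟦ y′ ⟧ + ⟦ δ ⟧ - ⟦ y′ ⟧              ≈⟨ +-congʳ (- ⟦ y′ ⟧) (⟦+⟧ y′ δ) ⟨
    ⟦ y′ ⊕ δ ⟧ - ⟦ y′ ⟧                  ≡⟨ cong (λ a → ⟦ a ⟧ - ⟦ y′ ⟧) y″≡y′+δ ⟨
    ⟦ y″ ⟧ - ⟦ y′ ⟧                      ≈⟨ +-congʳ (- ⟦ y′ ⟧) y″≈ ⟩
    ⟦ y′ ⟧ + σ₂ * + t * Pⱼ - ⟦ y′ ⟧      ≡⟨ cancel ⟦ y′ ⟧ (σ₂ * + t * Pⱼ) ⟩
    σ₂ * + t * Pⱼ                        ∎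
    where
    open ≈-Reasoning
    cancel : ∀ a b → a + b - a ≡ b
    cancel = solve-∀

    Pᵢ Pⱼ σ₁ σ₂ : ℤ
    Pᵢ = ⟦ k (layer g∈G i) ⟧
    Pⱼ = ⟦ k (layer g∈G j) ⟧
    σ₁ = proj₁ (along-cycle g∈G i x)
    σ₂ = proj₁ (along-cycle g∈G j y)

    s*≈₂0 : ∀ z → + s * z Parity.≈ + 0
    s*≈₂0 z = Parity.≈-trans (Parity.*-congʳ z (Parity.%≡⇒≈ {s} {0} s-even)) (Parity.≡⇒≈ (ℤₚ.*-zeroˡ z))

    e : Fin n
    e = [ s ℕ.* toℕ (k i) ]mod n
    e≈ : ⟦ e ⟧ ≈ + s * ⟦ k i ⟧
    e≈ = ≈-trans (⟦mod⟧ _) (≡⇒≈ (ℤₚ.pos-* s (toℕ (k i))))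

    x′ y′ x″ y″ δ : Fin n
    x′ = position g i x
    y′ = position g j y
    x″ = position g i (x ⊕ e)
    y″ = position g j (y ⊕ e)
    δ  = x″ ⊝ x′

    y″≈ : ⟦ y″ ⟧ ≈ ⟦ y′ ⟧ + σ₂ * + t * Pⱼ
    y″≈ = proj₂ (proj₂ (along-cycle g∈G j y)) t (y ⊕ e)
            (≈-trans (⟦+⟧ y e) (+-congˡ ⟦ y ⟧ (≈-trans e≈ sKᵢ≈tKⱼ)))

    δ≈ : ⟦ δ ⟧ ≈ σ₁ * + s * Pᵢ
    δ≈ = begin
      ⟦ δ ⟧                                 ≈⟨ ⊝-≈ x″ x′ ⟩
      ⟦ x″ ⟧ - ⟦ x′ ⟧                       ≈⟨ +-congʳ (- ⟦ x′ ⟧) x″≈ ⟩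
      ⟦ x′ ⟧ + σ₁ * + s * Pᵢ - ⟦ x′ ⟧       ≡⟨ cancel ⟦ x′ ⟧ (σ₁ * + s * Pᵢ) ⟩
      σ₁ * + s * Pᵢ                         ∎
      where
      x″≈ : ⟦ x″ ⟧ ≈ ⟦ x′ ⟧ + σ₁ * + s * Pᵢ
      x″≈ = proj₂ (proj₂ (along-cycle g∈G i x)) s (x ⊕ e) (≈-trans (⟦+⟧ x e) (+-congˡ ⟦ x ⟧ e≈))

    y″≡y′+δ : y″ ≡ y′ ⊕ δ
    y″≡y′+δ = cross-displacement g∈G e i≢j xy
      (Parity.≈-trans (≈⇒≈₂ e≈) (s*≈₂0 ⟦ k i ⟧))
      (Parity.≈-trans (≈⇒≈₂ δ≈) (Parity.≈-trans (Parity.≡⇒≈ (ℤₚ.*-assoc σ₁ (+ s) Pᵢ))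
        (Parity.≈-trans (Parity.*-congˡ σ₁ (s*≈₂0 Pᵢ)) (Parity.≡⇒≈ (ℤₚ.*-zeroʳ σ₁)))))

  -- Translate by 2k_i = (2 k_i u) k_j, where u k_j ≡ 1, and cancel the unit k_j.
  cross-congruence : ∀ {g} (g∈G : G g) {i x j y} → i ≢ j → X (i , x) (j , y) →
    + 2 * ⟦ k (layer g∈G i) ⟧ * ⟦ k j ⟧ ≈± + 2 * ⟦ k i ⟧ * ⟦ k (layer g∈G j) ⟧
  cross-congruence {g} g∈G {i} {x} {j} {y} i≢j xy =
    σ₁ * σ₂ , sign-* σ₁-sign σ₂-sign ,
    sign-unit-cancel {σ₁} {σ₂} {Pᵢ} {Pⱼ} {Kᵢ} {Kⱼ} {+ u} σ₁-sign uKⱼ≈1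
      (subst (λ z → σ₁ * + 2 * Pᵢ ≈ σ₂ * z * Pⱼ) +t≡ (translation-congruence g∈G i≢j xy 2 t refl 2Kᵢ≈tKⱼ))
    where
    Kᵢ Kⱼ Pᵢ Pⱼ : ℤ
    Kᵢ = ⟦ k i ⟧
    Kⱼ = ⟦ k j ⟧
    Pᵢ = ⟦ k (layer g∈G i) ⟧
    Pⱼ = ⟦ k (layer g∈G j) ⟧

    σ₁ σ₂ : ℤ
    σ₁ = proj₁ (along-cycle g∈G i x)
    σ₂ = proj₁ (along-cycle g∈G j y)
    σ₁-sign : IsSign σ₁
    σ₁-sign = proj₁ (proj₂ (along-cycle g∈G i x))
    σ₂-sign : IsSign σ₂
    σ₂-sign = proj₁ (proj₂ (along-cycle g∈G j y))

    u : ℕ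
    u = proj₁ (coprime⇒invertible (k-coprime j))
    uKⱼ≈1 : + u * Kⱼ ≈ + 1
    uKⱼ≈1 = proj₂ (coprime⇒invertible (k-coprime j))

    t : ℕ
    t = 2 ℕ.* toℕ (k i) ℕ.* u
    +t≡ : + t ≡ + 2 * Kᵢ * + u
    +t≡ = trans (ℤₚ.pos-* (2 ℕ.* toℕ (k i)) u) (cong (_* + u) (ℤₚ.pos-* 2 (toℕ (k i))))

    2Kᵢ≈tKⱼ : + 2 * Kᵢ ≈ + t * Kⱼ
    2Kᵢ≈tKⱼ = begin
      + 2 * Kᵢ                 ≡⟨ ℤₚ.*-identityʳ (+ 2 * Kᵢ) ⟨
      + 2 * Kᵢ * + 1           ≈⟨ *-congˡ (+ 2 * Kᵢ) uKⱼ≈1 ⟨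
      + 2 * Kᵢ * (+ u * Kⱼ)     ≡⟨ ℤₚ.*-assoc (+ 2 * Kᵢ) (+ u) Kⱼ ⟨
      + 2 * Kᵢ * + u * Kⱼ      ≡⟨ cong (_* Kⱼ) +t≡ ⟨
      + t * Kⱼ                 ∎
      where open ≈-Reasoning

  0ₙ : Fin n
  0ₙ = [ 0 ]mod n

  origin-up : Up 0ₘ 0ₙ 1ₘ 0ₙ
  origin-up = rung (trans [ 0 ]mod-parity (cong (_% 2) (sym toℕ-0ₘ)))
                   (subst (λ z → suc z ℕ.< m) (sym toℕ-0ₘ) 2≤m) refl refl

  -- If g sends an endpoint of a cross edge to u_{0,0}, it sends the other endpoint to
  -- u_{1,0}, the unique cross neighbour of u_{0,0}.
  cross-congruence-at-origin : ∀ {g} (g∈G : G g) {i x j y} → g (i , x) ≡ (0ₘ , 0ₙ) → i ≢ j →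
    X (i , x) (j , y) → + 2 * ⟦ k 0ₘ ⟧ * ⟦ k j ⟧ ≈± + 2 * ⟦ k i ⟧ * ⟦ k 1ₘ ⟧
  cross-congruence-at-origin {g} g∈G {i} {x} {j} {y} g[i,x]≡0 i≢j xy =
    subst₂ (λ a b → + 2 * ⟦ k a ⟧ * ⟦ k j ⟧ ≈± + 2 * ⟦ k i ⟧ * ⟦ k b ⟧)
      (cong proj₁ image≡0) layer-j≡1 (cross-congruence g∈G i≢j xy)
    where
    image≡0 : (layer g∈G i , position g i x) ≡ (0ₘ , 0ₙ)
    image≡0 = trans (sym (image g∈G i x)) g[i,x]≡0
    layer-j≡1 : layer g∈G j ≡ 1ₘ
    layer-j≡1 = proj₁ (cross-unique
      (subst (λ v → CrossEdge (proj₁ v) (proj₂ v) (layer g∈G j) (position g j y)) image≡0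
        (cross-edge (i≢j ∘ layer-injective g∈G) (map-edge g∈G xy)))
      (inj₁ origin-up))

  module _ (G-transitive : VertexTransitive G) where

    consecutive-congruence : ∀ i → + 2 * ⟦ k 0ₘ ⟧ * ⟦ k (next i) ⟧ ≈± + 2 * ⟦ k i ⟧ * ⟦ k 1ₘ ⟧
    consecutive-congruence i =
      let (_ , g∈G , g[i,a]≡0) = G-transitive (i , [ toℕ i ]mod n) (0ₘ , 0ₙ) in
      cross-congruence-at-origin g∈G g[i,a]≡0 (next≢ 2≤m i ∘ sym) (inj₁ (up⇒edge (proj₂ (up-from i))))

    first-congruence : + 2 * ⟦ k 0ₘ ⟧ * ⟦ k 0ₘ ⟧ ≈± + 2 * ⟦ k 1ₘ ⟧ * ⟦ k 1ₘ ⟧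
    first-congruence =
      let (_ , g∈G , g[1,0]≡0) = G-transitive (1ₘ , 0ₙ) (0ₘ , 0ₙ) in
      cross-congruence-at-origin g∈G g[1,0]≡0 (next≢ 2≤m 0ₘ) (inj₂ (up⇒edge origin-up))

module SignedPowers (m h : ℕ) .{{_ : NonZero m}} .{{_ : NonZero h}} where

  open Modular h
  open Cyclic m

  module _ (K : Fin m → ℤ) (K₀≡1 : K 0ₘ ≡ + 1)
           (K-step : ∀ i → K (next i) ≈± K i * K 1ₘ) (K₁²≈±1 : K 1ₘ * K 1ₘ ≈± + 1) where

    private
      K₁ : ℤ
      K₁ = K 1ₘ

    ≈±-power : ∀ t → K (index t) ≈± K₁ ^ t
    ≈±-power zero    = ≈±-reflexive K₀≡1
    ≈±-power (suc t) = ≈±-trans (≈±-reflexive (cong K (sym (next-index t))))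
      (≈±-trans (K-step (index t)) (≈±-trans (≈±-*-cong (≈±-power t) (≈±-refl {K₁}))
        (≈±-reflexive (ℤₚ.*-comm (K₁ ^ t) K₁))))

    power-by-parity : ∀ t → K₁ ^ t ≈± K₁ ^ (t % 2)
    power-by-parity t = ≈±-trans (≈±-reflexive (trans (cong (K₁ ^_) t≡) (ℤₚ.^-distribˡ-+-* K₁ (t % 2) _)))
      (≈±-trans (≈±-*-cong (≈±-refl {K₁ ^ (t % 2)}) (even-power (t ℕ./ 2)))
        (≈±-reflexive (ℤₚ.*-identityʳ (K₁ ^ (t % 2)))))
      where
      t≡ : t ≡ t % 2 ℕ.+ 2 ℕ.* (t ℕ./ 2)
      t≡ = trans (ℕD.m≡m%n+[m/n]*n t 2) (cong (t % 2 ℕ.+_) (ℕₚ.*-comm (t ℕ./ 2) 2))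
      even-power : ∀ q → K₁ ^ (2 ℕ.* q) ≈± + 1
      even-power q = subst (_≈± + 1) (ℤₚ.^-*-assoc K₁ 2 q)
        (≈±1-^ (subst (_≈± + 1) (cong (K₁ *_) (sym (ℤₚ.*-identityʳ K₁))) K₁²≈±1) q)

    K≈±power : ∀ i → K i ≈± K₁ ^ (toℕ i % 2)
    K≈±power i = subst (_≈± K₁ ^ (toℕ i % 2)) (cong K (index-toℕ i))
      (≈±-trans (≈±-power (toℕ i)) (power-by-parity (toℕ i)))

    -- Going once around the cycle gives 1 ≡ ±K₁^m.
    m-odd⇒K₁≈±1 : m % 2 ≡ 1 → K₁ ≈± + 1
    m-odd⇒K₁≈±1 m-odd = ≈±-sym (≈±-trans (≈±-reflexive (sym K₀≡1)) (≈±-trans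
      (≈±-reflexive (cong K (sym index-m))) (≈±-trans (≈±-power m) (≈±-trans (power-by-parity m)
        (≈±-reflexive (trans (cong (K₁ ^_) m-odd) (ℤₚ.^-identityʳ K₁)))))))

    classification : (∀ i → K i ≈± + 1) ⊎
                     (m % 2 ≡ 0 × ¬ (K₁ ≈± + 1) × ∀ i → K i ≈± K₁ ^ (toℕ i % 2))
    classification with K₁ ≈±? + 1 | %2≡0⊎%2≡1 m
    ... | yes K₁≈±1 | _ = inj₁ λ i → ≈±-trans (K≈±power i) (≈±1-^ K₁≈±1 (toℕ i % 2))
    ... | no K₁≉±1 | inj₁ m-even = inj₂ (m-even , K₁≉±1 , K≈±power)
    ... | no K₁≉±1 | inj₂ m-odd  = ⊥-elim (K₁≉±1 (m-odd⇒K₁≈±1 m-odd))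

module HalfModulus (n h : ℕ) .{{_ : NonZero n}} .{{_ : NonZero h}} (n≡2h : n ≡ 2 ℕ.* h) where

  open Modular n
  private
    module ₕ = Modular h

  +n≡2h : + n ≡ + 2 * + h
  +n≡2h = trans (cong +_ n≡2h) (ℤₚ.pos-* 2 h)

  h+h≈0 : + h + + h ≈ + 0
  h+h≈0 = mk≈ (divides (+ 1) (begin
    + h + + h - + 0   ≡⟨ double (+ h) ⟩
    + 1 * (+ 2 * + h) ≡⟨ cong (+ 1 *_) +n≡2h ⟨
    + 1 * + n         ∎))
    where
    open ≡-Reasoning
    double : ∀ h → h + h - + 0 ≡ + 1 * (+ 2 * h)
    double = solve-∀

  halve : ∀ {x y} → + 2 * x ≈ + 2 * y → x ₕ.≈ y
  halve {x} {y} (mk≈ (divides q eq)) = ₕ.mk≈ (divides q (ℤₚ.*-cancelˡ-≡ (+ 2) (x - y) (q * + h) (begin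
    + 2 * (x - y)       ≡⟨ distrib (+ 2) x y ⟩
    + 2 * x - + 2 * y   ≡⟨ eq ⟩
    q * + n             ≡⟨ cong (q *_) +n≡2h ⟩
    q * (+ 2 * + h)     ≡⟨ swap q (+ 2) (+ h) ⟩
    + 2 * (q * + h)     ∎)))
    where
    open ≡-Reasoning
    distrib : ∀ c x y → c * (x - y) ≡ c * x - c * y
    distrib = solve-∀
    swap : ∀ q c h → q * (c * h) ≡ c * (q * h)
    swap = solve-∀

  double : ∀ {x y} → x ₕ.≈ y → + 2 * x ≈ + 2 * y
  double {x} {y} (ₕ.mk≈ (divides q eq)) = mk≈ (divides q (begin
    + 2 * x - + 2 * y   ≡⟨ distrib (+ 2) x y ⟩
    + 2 * (x - y)       ≡⟨ cong (+ 2 *_) eq ⟩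
    + 2 * (q * + h)     ≡⟨ swap q (+ 2) (+ h) ⟨
    q * (+ 2 * + h)     ≡⟨ cong (q *_) +n≡2h ⟨
    q * + n             ∎))
    where
    open ≡-Reasoning
    distrib : ∀ c x y → c * x - c * y ≡ c * (x - y)
    distrib = solve-∀
    swap : ∀ q c h → q * (c * h) ≡ c * (q * h)
    swap = solve-∀

  halve± : ∀ {x y} → + 2 * x ≈± + 2 * y → x ₕ.≈± y
  halve± {x} {y} (σ , σ-sign , 2x≈σ2y) =
    σ , σ-sign , halve (≈-trans 2x≈σ2y (≡⇒≈ (swap σ (+ 2) y)))
    where
    swap : ∀ σ c y → σ * (c * y) ≡ c * (σ * y)
    swap = solve-∀

  lift : ∀ {x y} → x ₕ.≈ y → x ≈ y ⊎ x + + h ≈ y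
  lift {x} {y} (ₕ.mk≈ (divides q eq)) = by-parity (<2⇒≡0⊎≡1 (ℤD.n%ℕd<d q 2))
    where
    p : ℤ
    p = q ℤD./ℕ 2
    q≡ : ∀ {r} → q ℤD.%ℕ 2 ≡ r → q ≡ + r + p * + 2
    q≡ refl = ℤD.a≡a%ℕn+[a/ℕn]*n q 2
    by-parity : q ℤD.%ℕ 2 ≡ 0 ⊎ q ℤD.%ℕ 2 ≡ 1 → x ≈ y ⊎ x + + h ≈ y
    by-parity (inj₁ r≡0) = inj₁ (mk≈ (divides p (begin
      x - y                  ≡⟨ eq ⟩
      q * + h                ≡⟨ cong (_* + h) (q≡ r≡0) ⟩
      (+ 0 + p * + 2) * + h  ≡⟨ regroup p (+ h) ⟩
      p * (+ 2 * + h)        ≡⟨ cong (p *_) +n≡2h ⟨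
      p * + n                ∎)))
      where
      open ≡-Reasoning
      regroup : ∀ p h → (+ 0 + p * + 2) * h ≡ p * (+ 2 * h)
      regroup = solve-∀
    by-parity (inj₂ r≡1) = inj₂ (mk≈ (divides (p + + 1) (begin
      x + + h - y            ≡⟨ move x y (+ h) ⟩
      x - y + + h            ≡⟨ cong (_+ + h) eq ⟩
      q * + h + + h          ≡⟨ cong (λ z → z * + h + + h) (q≡ r≡1) ⟩
      (+ 1 + p * + 2) * + h + + h ≡⟨ regroup p (+ h) ⟩
      (p + + 1) * (+ 2 * + h) ≡⟨ cong ((p + + 1) *_) +n≡2h ⟨
      (p + + 1) * + n        ∎)))
      where
      open ≡-Reasoning
      move : ∀ x y h → x + h - y ≡ x - y + h
      move = solve-∀
      regroup : ∀ p h → (+ 1 + p * + 2) * h + h ≡ (p + + 1) * (+ 2 * h)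
      regroup = solve-∀

  lift± : ∀ {x y} → x ₕ.≈± y → x ≈± y ⊎ x + + h ≈± y
  lift± (σ , σ-sign , x≈σy) with lift x≈σy
  ... | inj₁ x≈ = inj₁ (σ , σ-sign , x≈)
  ... | inj₂ x+h≈ = inj₂ (σ , σ-sign , x+h≈)

  two : Fin n
  two = [ 2 ]mod n

  ⟦two*⟧ : ∀ a → ⟦ _*ₙ_ n two a ⟧ ≈ + 2 * ⟦ a ⟧
  ⟦two*⟧ a = ≈-trans (⟦*⟧ two a) (*-congʳ ⟦ a ⟧ (⟦mod⟧ 2))

  ⟦-two⟧ : ⟦ -ₙ_ n two ⟧ ≈ + 2 * - + 1
  ⟦-two⟧ = ≈-trans (⟦-⟧ two) (-‿cong (⟦mod⟧ 2))

  two*≡±two⇔≈±1 : ∀ a → (_*ₙ_ n two a ≡ two ⊎ _*ₙ_ n two a ≡ -ₙ_ n two) ⇔ ⟦ a ⟧ ₕ.≈± + 1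
  two*≡±two⇔≈±1 a = mk⇔ to from
    where
    to : _*ₙ_ n two a ≡ two ⊎ _*ₙ_ n two a ≡ -ₙ_ n two → ⟦ a ⟧ ₕ.≈± + 1
    to (inj₁ 2a≡2) = + 1 , inj₁ refl ,
      halve (≈-trans (≈-sym (⟦two*⟧ a)) (≈-trans (≡⇒≈ (cong ⟦_⟧ 2a≡2)) (⟦mod⟧ 2)))
    to (inj₂ 2a≡-2) = - + 1 , inj₂ refl ,
      halve (≈-trans (≈-sym (⟦two*⟧ a)) (≈-trans (≡⇒≈ (cong ⟦_⟧ 2a≡-2)) ⟦-two⟧))
    from : ⟦ a ⟧ ₕ.≈± + 1 → _*ₙ_ n two a ≡ two ⊎ _*ₙ_ n two a ≡ -ₙ_ n two
    from (_ , inj₁ refl , a≈1) =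
      inj₁ (⟦⟧-injective (≈-trans (⟦two*⟧ a) (≈-trans (double a≈1) (≈-sym (⟦mod⟧ 2)))))
    from (_ , inj₂ refl , a≈-1) =
      inj₂ (⟦⟧-injective (≈-trans (⟦two*⟧ a) (≈-trans (double a≈-1) (≈-sym ⟦-two⟧))))

involution⇒isomorphism : ∀ {V : Set} {E F : V → V → Set} {φ : V → V} → (∀ v → φ (φ v) ≡ v) →
  (∀ {u v} → E u v → F (φ u) (φ v)) → (∀ {u v} → F u v → E (φ u) (φ v)) → IsIsomorphism E F φ
involution⇒isomorphism {E = E} {φ = φ} φφ≡id E⇒F F⇒E =
  ((λ {u} {v} φu≡φv → trans (sym (φφ≡id u)) (trans (cong φ φu≡φv) (φφ≡id v))) ,
   (λ v → φ v , λ { refl → φφ≡id v })) ,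
  λ u v → mk⇔ E⇒F (λ Fφuφv → subst₂ E (φφ≡id u) (φφ≡id v) (F⇒E Fφuφv))

RelabelledAs : (m n : ℕ) .{{_ : NonZero m}} .{{_ : NonZero n}} → (Fin m → Fin n) → Fin n → (Fin m → Fin n) → Set
RelabelledAs m n k ℓ T = Σ (Vertex m n → Vertex m n) λ φ → (∀ v → proj₁ (φ v) ≡ proj₁ v) ×
  Σ (Fin n) λ ℓ′ → toℕ ℓ′ % 2 ≡ m % 2 × IsIsomorphism (Xa m n k ℓ) (Xa m n T ℓ′) φ

module Relabelling (m n : ℕ) .{{_ : NonZero m}} .{{_ : NonZero n}}
  (r r′ : Fin m → Fin n) (ℓ ℓ′ : Fin n) (f : Fin m → Fin n → Fin n) where

  open Cyclic m

  relabel : Vertex m n → Vertex m n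
  relabel v = proj₁ v , f (proj₁ v) (proj₂ v)

  module _ (f-cycle : ∀ i j → f i (j ⊕ r i) ≡ f i j ⊕ r′ i ⊎ f i j ≡ f i (j ⊕ r i) ⊕ r′ i)
           (f-parity : ∀ i j → toℕ (f i j) % 2 ≡ toℕ j % 2)
           (f-rung : ∀ i j → suc (toℕ i) ℕ.< m → toℕ j % 2 ≡ toℕ i % 2 → f i j ≡ f (next i) j)
           (f-wrap : ∀ i j → suc (toℕ i) ≡ m → toℕ j % 2 ≡ toℕ i % 2 → f i j ⊕ ℓ′ ≡ f (next i) (j ⊕ ℓ))
           where

    private
      E′ : Vertex m n → Vertex m n → Set
      E′ = XaEdge m n r′ ℓ′

    relabel-edge : ∀ {u v} → XaEdge m n r ℓ u v → Xa m n r′ ℓ′ (relabel u) (relabel v)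
    relabel-edge (cyc i j) with f-cycle i j
    ... | inj₁ eq = inj₁ (subst (λ b → E′ (i , f i j) (i , b)) (sym eq) (cyc i (f i j)))
    ... | inj₂ eq = inj₂ (subst (λ b → E′ (i , f i (j ⊕ r i)) (i , b)) (sym eq) (cyc i (f i (j ⊕ r i))))
    relabel-edge (rung i j i+1<m j~i) = inj₁ (subst (λ b → E′ (i , f i j) (next i , b)) (f-rung i j i+1<m j~i)
      (rung i (f i j) i+1<m (trans (f-parity i j) j~i)))
    relabel-edge (wrap i j i+1≡m j~i) = inj₁ (subst (λ b → E′ (i , f i j) (next i , b)) (f-wrap i j i+1≡m j~i)
      (wrap i (f i j) i+1≡m (trans (f-parity i j) j~i)))

    relabel-adjacent : ∀ {u v} → Xa m n r ℓ u v → Xa m n r′ ℓ′ (relabel u) (relabel v)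
    relabel-adjacent (inj₁ uv) = relabel-edge uv
    relabel-adjacent (inj₂ vu) with relabel-edge vu
    ... | inj₁ e = inj₂ e
    ... | inj₂ e = inj₁ e

module Untwisting (m n h : ℕ) .{{_ : NonZero m}} .{{_ : NonZero n}} .{{_ : NonZero h}}
  (n≡2h : n ≡ 2 ℕ.* h) where

  open Modular n
  open Cyclic m
  open HalfModulus n h n≡2h
  private
    module ₕ = Modular h
    module ₂ = Parity

  bit : Bool → ℤ
  bit false = + 0
  bit true  = + 1

  half : Fin n
  half = [ h ]mod n

  shift : Bool → Fin n → Fin n
  shift false j = j
  shift true  j = j ⊕ half

  ⟦shift⟧ : ∀ b j → ⟦ shift b j ⟧ ≈ ⟦ j ⟧ + + h * bit b
  ⟦shift⟧ false j = ≡⇒≈ (sym (trans (cong (_+_ ⟦ j ⟧) (ℤₚ.*-zeroʳ (+ h))) (ℤₚ.+-identityʳ ⟦ j ⟧)))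
  ⟦shift⟧ true  j = ≈-trans (⟦+⟧ j half) (+-congˡ ⟦ j ⟧ (≈-trans (⟦mod⟧ h) (≡⇒≈ (sym (ℤₚ.*-identityʳ (+ h))))))

  h*bit-xor : ∀ b c → + h * bit (b xor c) ≈ + h * bit b + + h * bit c
  h*bit-xor false c     = ≡⇒≈ (sym (trans (cong (_+ + h * bit c) (ℤₚ.*-zeroʳ (+ h))) (ℤₚ.+-identityˡ _)))
  h*bit-xor true  false = ≡⇒≈ (sym (trans (cong (_+_ (+ h * + 1)) (ℤₚ.*-zeroʳ (+ h))) (ℤₚ.+-identityʳ _)))
  h*bit-xor true  true  = begin
    + h * + 0              ≡⟨ ℤₚ.*-zeroʳ (+ h) ⟩
    + 0                    ≈⟨ h+h≈0 ⟨
    + h + + h              ≡⟨ cong₂ _+_ (ℤₚ.*-identityʳ (+ h)) (ℤₚ.*-identityʳ (+ h)) ⟨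
    + h * + 1 + + h * + 1  ∎
    where open ≈-Reasoning

  h*bit+h*bit≈0 : ∀ b → + h * bit b + + h * bit b ≈ + 0
  h*bit+h*bit≈0 b = ≈-trans (≈-sym (h*bit-xor b b))
    (≡⇒≈ (trans (cong (λ c → + h * bit c) (Boolₚ.xor-same b)) (ℤₚ.*-zeroʳ (+ h))))

  shift-shift : ∀ b c j → shift b (shift c j) ≡ shift (b xor c) j
  shift-shift b c j = ⟦⟧-injective (begin
    ⟦ shift b (shift c j) ⟧                  ≈⟨ ⟦shift⟧ b (shift c j) ⟩
    ⟦ shift c j ⟧ + + h * bit b              ≈⟨ +-congʳ (+ h * bit b) (⟦shift⟧ c j) ⟩
    ⟦ j ⟧ + + h * bit c + + h * bit b        ≡⟨ regroup ⟦ j ⟧ (+ h * bit c) (+ h * bit b) ⟩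
    ⟦ j ⟧ + (+ h * bit b + + h * bit c)      ≈⟨ +-congˡ ⟦ j ⟧ (h*bit-xor b c) ⟨
    ⟦ j ⟧ + + h * bit (b xor c)              ≈⟨ ⟦shift⟧ (b xor c) j ⟨
    ⟦ shift (b xor c) j ⟧                    ∎)
    where
    open ≈-Reasoning
    regroup : ∀ j x y → j + x + y ≡ j + (y + x)
    regroup = solve-∀

  shift-involutive : ∀ b j → shift b (shift b j) ≡ j
  shift-involutive b j = trans (shift-shift b b j) (cong (λ c → shift c j) (Boolₚ.xor-same b))

  shift-⊕-shift : ∀ b j l → shift b j ⊕ shift b l ≡ j ⊕ l
  shift-⊕-shift b j l = ⟦⟧-injective (begin
    ⟦ shift b j ⊕ shift b l ⟧                          ≈⟨ ⟦+⟧ (shift b j) (shift b l) ⟩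
    ⟦ shift b j ⟧ + ⟦ shift b l ⟧                      ≈⟨ +-cong (⟦shift⟧ b j) (⟦shift⟧ b l) ⟩
    ⟦ j ⟧ + + h * bit b + (⟦ l ⟧ + + h * bit b)        ≡⟨ regroup ⟦ j ⟧ ⟦ l ⟧ (+ h * bit b) ⟩
    ⟦ j ⟧ + ⟦ l ⟧ + (+ h * bit b + + h * bit b)        ≈⟨ +-congˡ (⟦ j ⟧ + ⟦ l ⟧) (h*bit+h*bit≈0 b) ⟩
    ⟦ j ⟧ + ⟦ l ⟧ + + 0                                ≡⟨ ℤₚ.+-identityʳ (⟦ j ⟧ + ⟦ l ⟧) ⟩
    ⟦ j ⟧ + ⟦ l ⟧                                      ≈⟨ ⟦+⟧ j l ⟨
    ⟦ j ⊕ l ⟧                                          ∎)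
    where
    open ≈-Reasoning
    regroup : ∀ j l e → j + e + (l + e) ≡ j + l + (e + e)
    regroup = solve-∀

  shift-⊕ : ∀ b j l → shift b j ⊕ l ≡ j ⊕ shift b l
  shift-⊕ b j l = ⟦⟧-injective (begin
    ⟦ shift b j ⊕ l ⟧                 ≈⟨ ⟦+⟧ (shift b j) l ⟩
    ⟦ shift b j ⟧ + ⟦ l ⟧             ≈⟨ +-congʳ ⟦ l ⟧ (⟦shift⟧ b j) ⟩
    ⟦ j ⟧ + + h * bit b + ⟦ l ⟧       ≡⟨ regroup ⟦ j ⟧ ⟦ l ⟧ (+ h * bit b) ⟩
    ⟦ j ⟧ + (⟦ l ⟧ + + h * bit b)     ≈⟨ +-congˡ ⟦ j ⟧ (⟦shift⟧ b l) ⟨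
    ⟦ j ⟧ + ⟦ shift b l ⟧             ≈⟨ ⟦+⟧ j (shift b l) ⟨
    ⟦ j ⊕ shift b l ⟧                 ∎)
    where
    open ≈-Reasoning
    regroup : ∀ j l e → j + e + l ≡ j + (l + e)
    regroup = solve-∀

  2∣n : 2 ℕ∣.∣ n
  2∣n = ℕ∣.divides h (trans n≡2h (ℕₚ.*-comm 2 h))

  shift-parity : ∀ b j → (b ≡ true → h % 2 ≡ 0) → toℕ (shift b j) % 2 ≡ toℕ j % 2
  shift-parity false j _      = refl
  shift-parity true  j h-even = ₂.≈⇒%≡ {toℕ (j ⊕ half)} {toℕ j} (begin
    ⟦ j ⊕ half ⟧       ≈⟨ ≈-weaken 2∣n (⟦shift⟧ true j) ⟩
    ⟦ j ⟧ + + h * + 1  ≡⟨ cong (_+_ ⟦ j ⟧) (ℤₚ.*-identityʳ (+ h)) ⟩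
    ⟦ j ⟧ + + h        ≈⟨ ₂.+-congˡ ⟦ j ⟧ (₂.%≡⇒≈ {h} {0} (h-even refl)) ⟩
    ⟦ j ⟧ + + 0        ≡⟨ ℤₚ.+-identityʳ ⟦ j ⟧ ⟩
    ⟦ j ⟧              ∎)
    where
    open ₂.≈-Reasoning

  odd-step-flips : ∀ (j r : Fin n) → toℕ r % 2 ≡ 1 → toℕ (j ⊕ r) % 2 ≢ toℕ j % 2
  odd-step-flips j r r-odd same = ₂.1≉0 (₂.+-cancelˡ ⟦ j ⟧ (begin
    ⟦ j ⟧ + + 1       ≈⟨ ₂.+-congˡ ⟦ j ⟧ (₂.%≡⇒≈ {toℕ r} {1} r-odd) ⟨
    ⟦ j ⟧ + ⟦ r ⟧      ≈⟨ ≈-weaken 2∣n (⟦+⟧ j r) ⟨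
    ⟦ j ⊕ r ⟧          ≈⟨ ₂.%≡⇒≈ {toℕ (j ⊕ r)} {toℕ j} same ⟩
    ⟦ j ⟧              ≡⟨ ℤₚ.+-identityʳ ⟦ j ⟧ ⟨
    ⟦ j ⟧ + + 0        ∎))
    where open ₂.≈-Reasoning

  swap-shifted : ∀ {σ x y e} → IsSign σ → e + e ≈ + 0 → x + e ≈ σ * y → y + e ≈ σ * x
  swap-shifted {x = x} {y} {e} (inj₁ refl) e+e≈0 x+e≈y = begin
    y + e               ≡⟨ cong (_+ e) (ℤₚ.*-identityˡ y) ⟨
    + 1 * y + e         ≈⟨ +-congʳ e x+e≈y ⟨
    x + e + e           ≡⟨ ℤₚ.+-assoc x e e ⟩
    x + (e + e)         ≈⟨ +-congˡ x e+e≈0 ⟩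
    x + + 0             ≡⟨ trans (ℤₚ.+-identityʳ x) (sym (ℤₚ.*-identityˡ x)) ⟩
    + 1 * x             ∎
    where open ≈-Reasoning
  swap-shifted {x = x} {y} {e} (inj₂ refl) _ x+e≈-y = begin
    y + e               ≡⟨ cong (_+ e) (negate-twice y) ⟩
    - (- + 1 * y) + e   ≈⟨ +-congʳ e (-‿cong x+e≈-y) ⟨
    - (x + e) + e       ≡⟨ cancel x e ⟩
    - + 1 * x           ∎
    where
    open ≈-Reasoning
    negate-twice : ∀ y → y ≡ - (- + 1 * y)
    negate-twice = solve-∀
    cancel : ∀ x e → - (x + e) + e ≡ - + 1 * x
    cancel = solve-∀

  odd+h≈±odd⇒h-even : ∀ {x y} → toℕ x % 2 ≡ 1 → toℕ y % 2 ≡ 1 → ⟦ x ⟧ + + h * + 1 ≈± ⟦ y ⟧ → h % 2 ≡ 0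
  odd+h≈±odd⇒h-even {x} {y} x-odd y-odd (σ , σ-sign , x+h≈σy) = ₂.≈⇒%≡ {h} {0} (₂.+-cancelˡ (+ 1) (begin
    + 1 + + h              ≈⟨ ₂.+-congʳ (+ h) (₂.%≡⇒≈ {toℕ x} {1} x-odd) ⟨
    ⟦ x ⟧ + + h            ≡⟨ cong (_+_ ⟦ x ⟧) (ℤₚ.*-identityʳ (+ h)) ⟨
    ⟦ x ⟧ + + h * + 1      ≈⟨ ≈-weaken 2∣n x+h≈σy ⟩
    σ * ⟦ y ⟧              ≈⟨ sign*≈ σ-sign ⟩
    ⟦ y ⟧                  ≈⟨ ₂.%≡⇒≈ {toℕ y} {1} y-odd ⟩
    + 1                    ≡⟨ ℤₚ.+-identityʳ (+ 1) ⟨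
    + 1 + + 0              ∎))
    where
    open ₂.≈-Reasoning
    sign*≈ : ∀ {σ z} → IsSign σ → σ * z ₂.≈ z
    sign*≈ {z = z} (inj₁ refl) = ₂.≡⇒≈ (ℤₚ.*-identityˡ z)
    sign*≈ {z = z} (inj₂ refl) = ₂.mk≈ (divides (- z) (ring z))
      where
      ring : ∀ z → - + 1 * z - z ≡ - z * + 2
      ring = solve-∀

  module _ (k T : Fin m → Fin n) (k-odd : ∀ i → toℕ (k i) % 2 ≡ 1) (T-odd : ∀ i → toℕ (T i) % 2 ≡ 1)
           (k≈±T : ∀ i → ⟦ k i ⟧ ₕ.≈± ⟦ T i ⟧) (k₀≡T₀ : k 0ₘ ≡ T 0ₘ)
           (ℓ : Fin n) (ℓ-parity : toℕ ℓ % 2 ≡ m % 2) where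

    -- ε i is set when k_i ≢ ±T_i modulo n = 2h; then k_i + h ≡ ±T_i instead.
    ε : Fin m → Bool
    ε i = not (does (⟦ k i ⟧ ≈±? ⟦ T i ⟧))

    k+hε≈±T : ∀ i → ⟦ k i ⟧ + + h * bit (ε i) ≈± ⟦ T i ⟧
    k+hε≈±T i = from-decision (⟦ k i ⟧ ≈±? ⟦ T i ⟧)
      where
      from-decision : (d : Dec (⟦ k i ⟧ ≈± ⟦ T i ⟧)) → ⟦ k i ⟧ + + h * bit (not (does d)) ≈± ⟦ T i ⟧
      from-decision (yes k≈±T′) =
        subst (_≈± ⟦ T i ⟧) (sym (trans (cong (_+_ ⟦ k i ⟧) (ℤₚ.*-zeroʳ (+ h))) (ℤₚ.+-identityʳ ⟦ k i ⟧))) k≈±T′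
      from-decision (no k≉±T) with lift± (k≈±T i)
      ... | inj₁ k≈±T′  = contradiction k≈±T′ k≉±T
      ... | inj₂ k+h≈±T = subst (λ z → ⟦ k i ⟧ + z ≈± ⟦ T i ⟧) (sym (ℤₚ.*-identityʳ (+ h))) k+h≈±T

    T+hε≈±k : ∀ i → ⟦ T i ⟧ + + h * bit (ε i) ≈± ⟦ k i ⟧
    T+hε≈±k i = let (σ , σ-sign , k+hε≈σT) = k+hε≈±T i in
      σ , σ-sign , swap-shifted {e = + h * bit (ε i)} σ-sign (h*bit+h*bit≈0 (ε i)) k+hε≈σT

    ε-true⇒h-even : ∀ i → ε i ≡ true → h % 2 ≡ 0
    ε-true⇒h-even i εᵢ≡true =
      odd+h≈±odd⇒h-even (k-odd i) (T-odd i) (subst (λ b → ⟦ k i ⟧ + + h * bit b ≈± ⟦ T i ⟧) εᵢ≡true (k+hε≈±T i))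

    ε₀≡false : ε 0ₘ ≡ false
    ε₀≡false with ⟦ k 0ₘ ⟧ ≈±? ⟦ T 0ₘ ⟧
    ... | yes _  = refl
    ... | no k≉T = contradiction (≈±-reflexive (cong ⟦_⟧ k₀≡T₀)) k≉T

    -- twist t = ε_1 xor ⋯ xor ε_t is the amount by which the relabelling shifts
    -- the vertices of C_t of the same parity as t.
    twist : ℕ → Bool
    twist zero    = false
    twist (suc t) = twist t xor ε (index (suc t))

    twist-step : ∀ i → twist (toℕ i) xor twist (toℕ i ∸ 1) ≡ ε i
    twist-step i = trans (step (toℕ i)) (cong ε (index-toℕ i))
      where
      cancel : ∀ a e → (a xor e) xor a ≡ e
      cancel false e     = Boolₚ.xor-identityʳ e
      cancel true  false = refl
      cancel true  true  = refl
      step : ∀ t → twist t xor twist (t ∸ 1) ≡ ε (index t)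
      step zero    = sym ε₀≡false
      step (suc t) = cancel (twist t) (ε (index (suc t)))

    twist-true⇒h-even : ∀ t → twist t ≡ true → h % 2 ≡ 0
    twist-true⇒h-even (suc t) tw with twist t | twist-true⇒h-even t
    ... | true  | ih = ih refl
    ... | false | _  = ε-true⇒h-even (index (suc t)) tw

    lagged-twist : ∀ {P : Set} → Dec P → ℕ → Bool
    lagged-twist (yes _) t = twist t
    lagged-twist (no _)  t = twist (t ∸ 1)

    γ : Fin m → Fin n → Bool
    γ i j = lagged-twist (toℕ j % 2 ℕ.≟ toℕ i % 2) (toℕ i)

    γ-same : ∀ i j → toℕ j % 2 ≡ toℕ i % 2 → γ i j ≡ twist (toℕ i)
    γ-same i j j~i with toℕ j % 2 ℕ.≟ toℕ i % 2
    ... | yes _   = refl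
    ... | no j≁i  = contradiction j~i j≁i

    γ-other : ∀ i j → toℕ j % 2 ≢ toℕ i % 2 → γ i j ≡ twist (toℕ i ∸ 1)
    γ-other i j j≁i with toℕ j % 2 ℕ.≟ toℕ i % 2
    ... | yes j~i = contradiction j~i j≁i
    ... | no _    = refl

    γ-true⇒h-even : ∀ i j → γ i j ≡ true → h % 2 ≡ 0
    γ-true⇒h-even i j = lagged (toℕ j % 2 ℕ.≟ toℕ i % 2)
      where
      lagged : ∀ {P : Set} (d : Dec P) → lagged-twist d (toℕ i) ≡ true → h % 2 ≡ 0
      lagged (yes _) = twist-true⇒h-even (toℕ i)
      lagged (no _)  = twist-true⇒h-even (toℕ i ∸ 1)

    γ-first : ∀ {i} j → toℕ i ≡ 0 → γ i j ≡ false
    γ-first {i} j i≡0 with toℕ j % 2 ℕ.≟ toℕ i % 2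
    ... | yes _ = cong twist i≡0
    ... | no _  = cong (λ t → twist (t ∸ 1)) i≡0

    γ-cycle : ∀ r → toℕ r % 2 ≡ 1 → ∀ i j → γ i j xor γ i (j ⊕ r) ≡ ε i
    γ-cycle r r-odd i j = by-parity (toℕ j % 2 ℕ.≟ toℕ i % 2)
      where
      by-parity : Dec (toℕ j % 2 ≡ toℕ i % 2) → γ i j xor γ i (j ⊕ r) ≡ ε i
      by-parity (yes j~i) = trans
        (cong₂ _xor_ (γ-same i j j~i) (γ-other i (j ⊕ r) (λ j′~i → odd-step-flips j r r-odd (trans j′~i (sym j~i)))))
        (twist-step i)
      by-parity (no j≁i)  = trans
        (cong₂ _xor_ (γ-other i j j≁i)
          (γ-same i (j ⊕ r) (%2-binary (toℕ j) (toℕ (j ⊕ r)) (toℕ i) j≁i (odd-step-flips j r r-odd))))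
        (trans (Boolₚ.xor-comm (twist (toℕ i ∸ 1)) (twist (toℕ i))) (twist-step i))

    γ-odd-step : ∀ r → toℕ r % 2 ≡ 1 → ∀ i j → γ i (j ⊕ r) ≡ γ i j xor ε i
    γ-odd-step r r-odd i j = begin
      c′                   ≡⟨ Boolₚ.xor-identityˡ c′ ⟨
      false xor c′         ≡⟨ cong (_xor c′) (Boolₚ.xor-same c) ⟨
      (c xor c) xor c′     ≡⟨ Boolₚ.xor-assoc c c c′ ⟩
      c xor (c xor c′)     ≡⟨ cong (c xor_) (γ-cycle r r-odd i j) ⟩
      c xor ε i            ∎
      where
      open ≡-Reasoning
      c c′ : Bool
      c  = γ i j
      c′ = γ i (j ⊕ r)

    f : Fin m → Fin n → Fin n
    f i j = shift (γ i j) j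

    f-parity : ∀ i j → toℕ (f i j) % 2 ≡ toℕ j % 2
    f-parity i j = shift-parity (γ i j) j (γ-true⇒h-even i j)

    f-involutive : ∀ i j → f i (f i j) ≡ j
    f-involutive i j = trans (cong (λ p → shift (lagged-twist (p ℕ.≟ toℕ i % 2) (toℕ i)) (f i j)) (f-parity i j))
                             (shift-involutive (γ i j) j)

    f-cycle : (r r′ : Fin m → Fin n) → (∀ i → toℕ (r i) % 2 ≡ 1) →
              (∀ i → ⟦ r i ⟧ + + h * bit (ε i) ≈± ⟦ r′ i ⟧) →
              ∀ i j → f i (j ⊕ r i) ≡ f i j ⊕ r′ i ⊎ f i j ≡ f i (j ⊕ r i) ⊕ r′ i
    f-cycle r r′ r-odd r+hε≈±r′ i j = ±step⇒adjacent σ-sign (begin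
      ⟦ f i (j ⊕ r i) ⟧                                     ≈⟨ ⟦shift⟧ c′ (j ⊕ r i) ⟩
      ⟦ j ⊕ r i ⟧ + + h * bit c′                             ≡⟨ cong (λ b → ⟦ j ⊕ r i ⟧ + + h * bit b) (γ-odd-step (r i) (r-odd i) i j) ⟩
      ⟦ j ⊕ r i ⟧ + + h * bit (c xor ε i)                    ≈⟨ +-cong (⟦+⟧ j (r i)) (h*bit-xor c (ε i)) ⟩
      ⟦ j ⟧ + ⟦ r i ⟧ + (+ h * bit c + + h * bit (ε i))      ≡⟨ regroup ⟦ j ⟧ ⟦ r i ⟧ (+ h * bit c) (+ h * bit (ε i)) ⟩
      ⟦ j ⟧ + + h * bit c + (⟦ r i ⟧ + + h * bit (ε i))      ≈⟨ +-cong (⟦shift⟧ c j) (≈-sym r+hε≈σr′) ⟨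
      ⟦ f i j ⟧ + σ * ⟦ r′ i ⟧                               ∎)
      where
      open ≈-Reasoning
      c c′ : Bool
      c  = γ i j
      c′ = γ i (j ⊕ r i)
      σ : ℤ
      σ = proj₁ (r+hε≈±r′ i)
      σ-sign : IsSign σ
      σ-sign = proj₁ (proj₂ (r+hε≈±r′ i))
      r+hε≈σr′ : ⟦ r i ⟧ + + h * bit (ε i) ≈ σ * ⟦ r′ i ⟧
      r+hε≈σr′ = proj₂ (proj₂ (r+hε≈±r′ i))
      regroup : ∀ j r x e → j + r + (x + e) ≡ j + x + (r + e)
      regroup = solve-∀

    f-rung : ∀ i j → suc (toℕ i) ℕ.< m → toℕ j % 2 ≡ toℕ i % 2 → f i j ≡ f (next i) j
    f-rung i j i+1<m j~i = cong (λ b → shift b j) (trans (γ-same i j j~i) (sym (trans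
      (γ-other (next i) j (λ j~i+1 →
        x%2≢[1+x]%2 (toℕ i) (trans (sym j~i) (trans j~i+1 (cong (_% 2) (toℕ-next i i+1<m))))))
      (cong (λ t → twist (t ∸ 1)) (toℕ-next i i+1<m)))))

    shift-at-last : ∀ i j → suc (toℕ i) ≡ m → toℕ j % 2 ≡ toℕ i % 2 → f i j ≡ shift (twist (m ∸ 1)) j
    shift-at-last i j i+1≡m j~i = cong (λ b → shift b j) (trans (γ-same i j j~i) (cong (λ t → twist (t ∸ 1)) i+1≡m))

    f-first : ∀ i j → suc (toℕ i) ≡ m → f (next i) j ≡ j
    f-first i j i+1≡m = cong (λ b → shift b j) (γ-first j (toℕ-next-last i i+1≡m))

    ℓ′ : Fin n
    ℓ′ = shift (twist (m ∸ 1)) ℓ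

    ℓ′-parity : toℕ ℓ′ % 2 ≡ m % 2
    ℓ′-parity = trans (shift-parity (twist (m ∸ 1)) ℓ (twist-true⇒h-even (m ∸ 1))) ℓ-parity

    f-wrap : ∀ i j → suc (toℕ i) ≡ m → toℕ j % 2 ≡ toℕ i % 2 → f i j ⊕ ℓ′ ≡ f (next i) (j ⊕ ℓ)
    f-wrap i j i+1≡m j~i = trans (cong (_⊕ ℓ′) (shift-at-last i j i+1≡m j~i))
      (trans (shift-⊕-shift (twist (m ∸ 1)) j ℓ) (sym (f-first i (j ⊕ ℓ) i+1≡m)))

    f-wrap⁻¹ : ∀ i j → suc (toℕ i) ≡ m → toℕ j % 2 ≡ toℕ i % 2 → f i j ⊕ ℓ ≡ f (next i) (j ⊕ ℓ′)
    f-wrap⁻¹ i j i+1≡m j~i = trans (cong (_⊕ ℓ) (shift-at-last i j i+1≡m j~i))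
      (trans (shift-⊕ (twist (m ∸ 1)) j ℓ) (sym (f-first i (j ⊕ ℓ′) i+1≡m)))

    untwist : RelabelledAs m n k ℓ T
    untwist = Forward.relabel , (λ _ → refl) , ℓ′ , ℓ′-parity ,
      involution⇒isomorphism {E = Xa m n k ℓ} {F = Xa m n T ℓ′} {φ = Forward.relabel}
        (λ v → cong (proj₁ v ,_) (f-involutive (proj₁ v) (proj₂ v)))
        (Forward.relabel-adjacent (f-cycle k T k-odd k+hε≈±T) f-parity f-rung f-wrap)
        (Backward.relabel-adjacent (f-cycle T k T-odd T+hε≈±k) f-parity f-rung f-wrap⁻¹)
      where
      module Forward  = Relabelling m n k T ℓ ℓ′ f
      module Backward = Relabelling m n T k ℓ′ ℓ f

coprime-to-even⇒odd : ∀ {c n} → n % 2 ≡ 0 → Coprime c n → c % 2 ≡ 1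
coprime-to-even⇒odd {c} {n} n-even c⊥n with %2≡0⊎%2≡1 c
... | inj₂ c-odd  = c-odd
... | inj₁ c-even with c⊥n (ℕ∣.m%n≡0⇒n∣m c 2 c-even , ℕ∣.m%n≡0⇒n∣m n 2 n-even)
...   | ()

Outcome : (m n : ℕ) .{{_ : NonZero m}} .{{_ : NonZero n}} → (Fin m → Fin n) → Fin n → Set
Outcome m n k ℓ =
  Σ (Vertex m n → Vertex m n) λ φ →
    (∀ v → proj₁ (φ v) ≡ proj₁ v) ×
    ((Σ (Fin n) λ ℓ' → toℕ ℓ' % 2 ≡ m % 2 ×
        IsIsomorphism (Xa m n k ℓ) (HTG m n ℓ') φ)
     ⊎
     (m % 2 ≡ 0 ×
      Σ (Fin n) λ ℓ' → Σ (Fin n) λ k' →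
        toℕ ℓ' % 2 ≡ m % 2 ×
        toℕ k' % 2 ≡ 1 ×
        _*ₙ_ n ([ 2 ]mod n) k' ≢ [ 2 ]mod n ×
        _*ₙ_ n ([ 2 ]mod n) k' ≢ -ₙ_ n ([ 2 ]mod n) ×
        (_*ₙ_ n ([ 2 ]mod n) (_*ₙ_ n k' k') ≡ [ 2 ]mod n ⊎
         _*ₙ_ n ([ 2 ]mod n) (_*ₙ_ n k' k') ≡ -ₙ_ n ([ 2 ]mod n)) ×
        IsIsomorphism (Xa m n k ℓ) (Xa m n (alt m n k') ℓ') φ))

module Outcomes (m n h : ℕ) .{{_ : NonZero m}} .{{_ : NonZero n}} .{{_ : NonZero h}}
  (n≡2h : n ≡ 2 ℕ.* h) (1<n : 1 ℕ.< n)
  (k : Fin m → Fin n) (k-odd : ∀ i → toℕ (k i) % 2 ≡ 1) (k₀≡1 : k (Cyclic.0ₘ m) ≡ [ 1 ]mod n)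
  (ℓ : Fin n) (ℓ-parity : toℕ ℓ % 2 ≡ m % 2) where

  open Modular n
  open Cyclic m
  open HalfModulus n h n≡2h
  open Untwisting m n h n≡2h
  private
    module ₕ = Modular h

  K : Fin m → ℤ
  K i = ⟦ k i ⟧

  ⟦1⟧≡1 : ⟦ [ 1 ]mod n ⟧ ≡ + 1
  ⟦1⟧≡1 = cong +_ (toℕ-[]mod 1 1<n)

  K₀≡1 : K 0ₘ ≡ + 1
  K₀≡1 = trans (cong ⟦_⟧ k₀≡1) ⟦1⟧≡1

  recurrence : (∀ i → + 2 * K 0ₘ * K (next i) ≈± + 2 * K i * K 1ₘ) → ∀ i → K (next i) ₕ.≈± K i * K 1ₘ
  recurrence congruence i = halve± (subst₂ _≈±_
    (cong (λ z → + 2 * z * K (next i)) K₀≡1) (ℤₚ.*-assoc (+ 2) (K i) (K 1ₘ)) (congruence i))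

  square : + 2 * K 0ₘ * K 0ₘ ≈± + 2 * K 1ₘ * K 1ₘ → K 1ₘ * K 1ₘ ₕ.≈± + 1
  square congruence = ₕ.≈±-sym (halve± (subst₂ _≈±_
    (cong (λ z → + 2 * z * z) K₀≡1) (ℤₚ.*-assoc (+ 2) (K 1ₘ) (K 1ₘ)) congruence))

  htg-case : (∀ i → K i ₕ.≈± + 1) → Outcome m n k ℓ
  htg-case K≈±1 = let (φ , φ-layers , ℓ′ , ℓ′-parity , φ-iso) = r in
    φ , φ-layers , inj₁ (ℓ′ , ℓ′-parity , φ-iso)
    where
    r : RelabelledAs m n k ℓ (λ _ → [ 1 ]mod n)
    r = untwist k (λ _ → [ 1 ]mod n) k-odd (λ _ → cong (_% 2) (toℕ-[]mod 1 1<n))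
          (λ i → subst (K i ₕ.≈±_) (sym ⟦1⟧≡1) (K≈±1 i)) k₀≡1 ℓ ℓ-parity

  alt-even : ∀ k′ i → toℕ i % 2 ≡ 0 → alt m n k′ i ≡ [ 1 ]mod n
  alt-even k′ i i-even rewrite i-even = refl

  alt-odd : ∀ k′ i → toℕ i % 2 ≡ 1 → alt m n k′ i ≡ k′
  alt-odd k′ i i-odd rewrite i-odd = refl

  alternating-case : m % 2 ≡ 0 → ¬ (K 1ₘ ₕ.≈± + 1) → K 1ₘ * K 1ₘ ₕ.≈± + 1 →
                     (∀ i → K i ₕ.≈± K 1ₘ ^ (toℕ i % 2)) → Outcome m n k ℓ
  alternating-case m-even K₁≉±1 K₁²≈±1 K≈±K₁^ = let (φ , φ-layers , ℓ′ , ℓ′-parity , φ-iso) = r in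
    φ , φ-layers , inj₂ (m-even , ℓ′ , k′ , ℓ′-parity , k-odd 1ₘ , 2k′≢2 , 2k′≢-2 , 2k′²≡±2 , φ-iso)
    where
    k′ : Fin n
    k′ = k 1ₘ

    2k′≢2 : _*ₙ_ n two k′ ≢ two
    2k′≢2 2k′≡2 = K₁≉±1 (Equivalence.to (two*≡±two⇔≈±1 k′) (inj₁ 2k′≡2))

    2k′≢-2 : _*ₙ_ n two k′ ≢ -ₙ_ n two
    2k′≢-2 2k′≡-2 = K₁≉±1 (Equivalence.to (two*≡±two⇔≈±1 k′) (inj₂ 2k′≡-2))

    2k′²≡±2 : _*ₙ_ n two (_*ₙ_ n k′ k′) ≡ two ⊎ _*ₙ_ n two (_*ₙ_ n k′ k′) ≡ -ₙ_ n two
    2k′²≡±2 = Equivalence.from (two*≡±two⇔≈±1 (_*ₙ_ n k′ k′))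
      (ₕ.≈±-trans (ₕ.≈⇒≈± (≈-weaken (ℕ∣.divides 2 n≡2h) (⟦*⟧ k′ k′))) K₁²≈±1)

    T : Fin m → Fin n
    T = alt m n k′

    T-odd : ∀ i → toℕ (T i) % 2 ≡ 1
    T-odd i with %2≡0⊎%2≡1 (toℕ i)
    ... | inj₁ i-even = trans (cong (λ a → toℕ a % 2) (alt-even k′ i i-even))
                                (cong (_% 2) (toℕ-[]mod 1 1<n))
    ... | inj₂ i-odd  = trans (cong (λ a → toℕ a % 2) (alt-odd k′ i i-odd)) (k-odd 1ₘ)

    K≈±T : ∀ i → K i ₕ.≈± ⟦ T i ⟧
    K≈±T i with %2≡0⊎%2≡1 (toℕ i)
    ... | inj₁ i-even = subst (K i ₕ.≈±_)
      (trans (cong (K 1ₘ ^_) i-even) (sym (trans (cong ⟦_⟧ (alt-even k′ i i-even)) ⟦1⟧≡1))) (K≈±K₁^ i)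
    ... | inj₂ i-odd  = subst (K i ₕ.≈±_)
      (trans (cong (K 1ₘ ^_) i-odd) (trans (ℤₚ.^-identityʳ (K 1ₘ)) (sym (cong ⟦_⟧ (alt-odd k′ i i-odd)))))
      (K≈±K₁^ i)

    r : RelabelledAs m n k ℓ T
    r = untwist k T k-odd T-odd K≈±T (trans k₀≡1 (sym (alt-even k′ 0ₘ (cong (_% 2) toℕ-0ₘ)))) ℓ ℓ-parity

proposition5p7 : (m n : ℕ) .{{_ : NonZero m}} .{{_ : NonZero n}} →
    3 ≤ m → 6 ≤ n → n % 2 ≡ 0 →
    (ℓ : Fin n) → toℕ ℓ % 2 ≡ m % 2 →
    (k : Fin m → Fin n) → k ([ 0 ]mod m) ≡ [ 1 ]mod n →
    (∀ i → Coprime (toℕ (k i)) n) →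
    (G : (Vertex m n → Vertex m n) → Set) →
    IsAutSubgroup (Xa m n k ℓ) G → VertexTransitive G → Preserves𝒞 G →
    Σ (Vertex m n → Vertex m n) λ φ →
      (∀ v → proj₁ (φ v) ≡ proj₁ v) ×
      ((Σ (Fin n) λ ℓ' → toℕ ℓ' % 2 ≡ m % 2 ×
          IsIsomorphism (Xa m n k ℓ) (HTG m n ℓ') φ)
       ⊎
       (m % 2 ≡ 0 ×
        Σ (Fin n) λ ℓ' → Σ (Fin n) λ k' →
          toℕ ℓ' % 2 ≡ m % 2 ×
          toℕ k' % 2 ≡ 1 ×
          _*ₙ_ n ([ 2 ]mod n) k' ≢ [ 2 ]mod n ×
          _*ₙ_ n ([ 2 ]mod n) k' ≢ -ₙ_ n ([ 2 ]mod n) ×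
          (_*ₙ_ n ([ 2 ]mod n) (_*ₙ_ n k' k') ≡ [ 2 ]mod n ⊎
           _*ₙ_ n ([ 2 ]mod n) (_*ₙ_ n k' k') ≡ -ₙ_ n ([ 2 ]mod n)) ×
          IsIsomorphism (Xa m n k ℓ) (Xa m n (alt m n k') ℓ') φ))
proposition5p7 m n 3≤m 6≤n n-even ℓ ℓ-parity k k₀≡1 k-coprime G G≤Aut G-transitive G-preserves =
  [ htg-case , (λ (m-even , K₁≉±1 , K≈±K₁^) → alternating-case m-even K₁≉±1 K₁²≈±1 K≈±K₁^) ]′
    (SignedPowers.classification m h K K₀≡1 K-step K₁²≈±1)
  where
  h : ℕ
  h = n ℕ./ 2
  n≡2h : n ≡ 2 ℕ.* h
  n≡2h = sym (ℕD.m*[n/m]≡n (ℕ∣.m%n≡0⇒n∣m n 2 n-even))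
  instance
    h-nonZero : NonZero h
    h-nonZero = ℕ.≢-nonZero (λ h≡0 → ℕ.≢-nonZero⁻¹ n (trans n≡2h (cong (2 ℕ.*_) h≡0)))
  2≤m : 2 ≤ m
  2≤m = ℕₚ.≤-trans (ℕₚ.n≤1+n 2) 3≤m
  2<n : 2 ℕ.< n
  2<n = ℕₚ.≤-trans (ℕ.s≤s (ℕ.s≤s (ℕ.s≤s ℕ.z≤n))) 6≤n
  k-odd : ∀ i → toℕ (k i) % 2 ≡ 1
  k-odd i = coprime-to-even⇒odd n-even (k-coprime i)
  module ₕ = Modular h
  open Cyclic m
  open LayerPreservingAutomorphisms m n 2≤m 2<n n-even k ℓ ℓ-parity k-coprime G G≤Aut G-preserves
  open Outcomes m n h n≡2h (ℕₚ.<-trans (ℕₚ.n<1+n 1) 2<n) k k-odd k₀≡1 ℓ ℓ-parity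
  K-step : ∀ i → K (next i) ₕ.≈± K i * K 1ₘ
  K-step = recurrence (consecutive-congruence G-transitive)
  K₁²≈±1 : K 1ₘ * K 1ₘ ₕ.≈± + 1
  K₁²≈±1 = square (first-congruence G-transitive)
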